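{- Let $G=(V,E)$ be a graph, $k\ge 0$ rational, $w:V\to[0,\infty)$ a rational weighting, and let $\kappa$ be a partial fractional $k\wr w$-colouring of $G$. Let $X$ be the set of vertices $v$ with $|\kappa[v]|<w(v)$. Suppose that for every $X'\subseteq X$, $$\left|\bigcup_{v\in X'}\alpha(v)\right| \geq \sum_{v\in X'} w(v).$$ Then there is a fractional $k\wr w$-colouring of $G$.
   Context: All numbers are rational. Let $\mathcal S$ be the set of stable sets of $G$. A map $\kappa$ assigning to each $S\in\mathcal S$ a subset $\kappa(S)\subseteq[0,k)$ which is a finite union of disjoint half-open intervals $[a,b)$ with rational endpoints in $[0,k]$, such that $\kappa(S)\cap\kappa(S')=\emptyset$ for distinct $S,S'$, is called a partial fractional $k\wr w$-colouring. For $v\in V$ let $\kappa[v]=\bigcup_{S\ni v}\kappa(S)$, and for $Y\subseteq V$ let $\kappa[Y]=\bigcup_{v\in Y}\kappa[v]$. The set of colours available to $v$ is $\alpha(v)=[0,k)\setminus\kappa[N(v)]$, where $N(v)$ is the (open) neighbourhood. $|\cdot|$ denotes total length (Lebesgue measure). $\kappa$ is a fractional $k\wr w$-colouring if $|\kappa[v]|\ge w(v)$ for every $v\in V$. -}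

module Defs where

open import Data.Bool using (Bool; true; false; _∧_; _∨_; not; if_then_else_)
open import Data.Nat using (ℕ; zero; suc)
open import Data.Fin using (Fin)
open import Data.Fin.Subset using (Subset; inside; outside)
open import Data.Vec using (Vec; []; _∷_; lookup)
open import Data.List using (List; []; _∷_; map; _++_; foldr; filter; allFin)
open import Data.List.Membership.Propositional using (_∈_)
open import Data.Product using (_×_; _,_)
open import Data.Rational using (ℚ; 0ℚ; _+_; _-_; _≤_; _≤ᵇ_)
open import Data.Rational.Properties using (≤-decTotalOrder)
open import Data.List.Sort.MergeSort ≤-decTotalOrder using (mergeSort)
open import Data.List.Sort.Base using (SortingAlgorithm)
open import Relation.Binary.PropositionalEquality using (_≡_; _≢_)
open import Relation.Nullary.Decidable using (Dec)

record Graph (n : ℕ) : Set where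
  field
    adj     : Fin n → Fin n → Bool
    adj-sym : ∀ u v → adj u v ≡ adj v u
    irrefl  : ∀ v → adj v v ≡ false
open Graph public

_∈ᵇ_ : ∀ {n} → Fin n → Subset n → Bool
v ∈ᵇ S = lookup S v

allSubsets : (n : ℕ) → List (Subset n)
allSubsets zero    = [] ∷ []
allSubsets (suc n) = map (outside ∷_) (allSubsets n) ++ map (inside ∷_) (allSubsets n)

allᵇ : ∀ {A : Set} → (A → Bool) → List A → Bool
allᵇ p = foldr (λ x acc → p x ∧ acc) true

stableᵇ : ∀ {n} → Graph n → Subset n → Bool
stableᵇ {n} G S =
  allᵇ (λ u → allᵇ (λ v → not ((u ∈ᵇ S) ∧ (v ∈ᵇ S) ∧ adj G u v)) (allFin n)) (allFin n)

Stable : ∀ {n} → Graph n → Subset n → Set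
Stable G S = stableᵇ G S ≡ true

-- Subsets of the rational line that are Boolean combinations of
-- half-open intervals [a , b) with rational endpoints, and their
-- (Lebesgue) measure.

data Region : Set where
  ∅ᴿ   : Region
  ival : ℚ → ℚ → Region
  _∪ᴿ_ : Region → Region → Region
  _∖ᴿ_ : Region → Region → Region

memᴿ : Region → ℚ → Bool
memᴿ ∅ᴿ         x = false
memᴿ (ival a b) x = (a ≤ᵇ x) ∧ not (b ≤ᵇ x)
memᴿ (r ∪ᴿ s)   x = memᴿ r x ∨ memᴿ s x
memᴿ (r ∖ᴿ s)   x = memᴿ r x ∧ not (memᴿ s x)

endsᴿ : Region → List ℚ
endsᴿ ∅ᴿ         = []
endsᴿ (ival a b) = a ∷ b ∷ []
endsᴿ (r ∪ᴿ s)   = endsᴿ r ++ endsᴿ s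
endsᴿ (r ∖ᴿ s)   = endsᴿ r ++ endsᴿ s

stepSum : (ℚ → Bool) → List ℚ → ℚ
stepSum χ (p ∷ q ∷ ps) = (if χ p then q - p else 0ℚ) + stepSum χ (q ∷ ps)
stepSum χ _            = 0ℚ

-- total length |r|: membership is constant on each piece [p_i , p_{i+1})
-- between consecutive sorted endpoints, and r is empty outside them.
measure : Region → ℚ
measure r = stepSum (memᴿ r) (SortingAlgorithm.sort mergeSort (endsᴿ r))

⋃ᴿ : List Region → Region
⋃ᴿ = foldr _∪ᴿ_ ∅ᴿ

IntervalUnion : Set
IntervalUnion = List (ℚ × ℚ)

toRegion : IntervalUnion → Region
toRegion I = ⋃ᴿ (map (λ { (a , b) → ival a b }) I)

-- κ(S) for each subset S; only the values on stable sets matter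
Assignment : ℕ → Set
Assignment n = Subset n → IntervalUnion

module _ {n : ℕ} (G : Graph n) where

  stableSets : List (Subset n)
  stableSets = filter (λ S → Dec-stable S) (allSubsets n)
    where
      open import Data.Bool using (T)
      open import Data.Bool.Properties using (T?)
      Dec-stable : (S : Subset n) → Dec (T (stableᵇ G S))
      Dec-stable S = T? (stableᵇ G S)

  κ[_]ᵛ : Assignment n → Fin n → Region
  κ[ κ ]ᵛ v = ⋃ᴿ (map (λ S → if v ∈ᵇ S then toRegion (κ S) else ∅ᴿ) stableSets)

  -- α(v) = [0,k) ∖ κ[N(v)]
  avail : ℚ → Assignment n → Fin n → Region
  avail k κ v =
    ival 0ℚ k ∖ᴿ ⋃ᴿ (map (λ u → if adj G v u then κ[ κ ]ᵛ u else ∅ᴿ) (allFin n))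

  record IsPartialColouring (k : ℚ) (κ : Assignment n) : Set where
    field
      inRange  : ∀ S → Stable G S → ∀ {a b} → (a , b) ∈ κ S →
                 (0ℚ ≤ a) × (a ≤ b) × (b ≤ k)
      disjoint : ∀ S S' → Stable G S → Stable G S' → S ≢ S' →
                 ∀ x → memᴿ (toRegion (κ S)) x ≡ true →
                       memᴿ (toRegion (κ S')) x ≡ false

  IsFractionalColouring : ℚ → (Fin n → ℚ) → Assignment n → Set
  IsFractionalColouring k w κ =
    IsPartialColouring k κ × (∀ v → w v ≤ measure (κ[ κ ]ᵛ v))

sumOver : ∀ {n} → Subset n → (Fin n → ℚ) → ℚ
sumOver {n} X w = foldr (λ v acc → (if v ∈ᵇ X then w v else 0ℚ) + acc) 0ℚ (allFin n)

module Submission where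

-- Cut [0,k) at every endpoint occurring in κ into cells on which the colour classes and the
-- availability of every vertex are constant. A cell offers its length to the vertices of X available
-- on it; Hall's condition says that every X' ⊆ X is offered supply(X') ≥ w(X'). While some cell c is
-- available to two vertices u ≠ v, cut it into a left piece no longer available to v and a right
-- piece of length t no longer available to u, where t is the least of |c| and the slacks
-- supply(X') - w(X') of the sets X' meeting c only in u. Hall's condition survives by the choice of t
-- and the submodularity of supply. Once every cell is available to at most one vertex of X, recolour:
-- a cell keeps the old colours of the vertices outside X and is given to its available vertex of X.
-- The new class is stable because that vertex is available there, vertices outside X keep their
-- colours, and Hall's condition for {v} gives |κ'[v]| ≥ w(v) for v ∈ X.

open import Data.Bool using (Bool; true; false; _∧_; _∨_; not; if_then_else_; T)
open import Data.Bool.Properties using (∧-zeroʳ; ∨-zeroʳ)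
open import Data.Nat using (ℕ; suc)
open import Data.Fin using (Fin; _≟_)
open import Data.Fin.Subset using (Subset) renaming (_∈_ to _∈ₛ_; _⊆_ to _⊆ₛ_)
open import Data.Vec using ([]; _∷_; lookup)
open import Data.List using (List; []; _∷_; _++_; foldr; map; allFin; filter)
open import Data.List.Relation.Unary.Any using (here; there)
open import Data.Product using (Σ; _×_; _,_; proj₁; proj₂)
open import Data.Sum using (_⊎_; inj₁; inj₂)
open import Data.Rational using (ℚ; 0ℚ; _+_; _-_; -_; _≤_; _<_; _≤ᵇ_)
open import Data.Rational.Properties hiding (_≟_)
open import Data.Rational.Solver using (module +-*-Solver)
open import Relation.Binary.PropositionalEquality
open import Relation.Nullary using (¬_; Dec; yes; no; does; contradiction)
open import Defs

module OrderFacts where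

  open +-*-Solver
  open import Data.Empty using (⊥-elim)
  open import Relation.Binary.Definitions using (tri<; tri≈; tri>)

  <⇒≱ : ∀ {x y} → x < y → ¬ (y ≤ x)
  <⇒≱ x<y y≤x = <-irrefl refl (<-≤-trans x<y y≤x)

  ≤⇒<⊎≡ : ∀ {x y} → x ≤ y → x < y ⊎ x ≡ y
  ≤⇒<⊎≡ {x} {y} x≤y with <-cmp x y
  ... | tri< x<y _ _ = inj₁ x<y
  ... | tri≈ _ x≡y _ = inj₂ x≡y
  ... | tri> _ _ y<x = ⊥-elim (<⇒≱ y<x x≤y)

  ≤ᵇ-true : ∀ {p q} → p ≤ q → (p ≤ᵇ q) ≡ true
  ≤ᵇ-true {p} {q} p≤q with p ≤ᵇ q | ≤⇒≤ᵇ {p} {q} p≤q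
  ... | true | _ = refl

  ≤ᵇ-true⁻ : ∀ {p q} → (p ≤ᵇ q) ≡ true → p ≤ q
  ≤ᵇ-true⁻ e = ≤ᵇ⇒≤ (subst T (sym e) _)

  ≤ᵇ-false : ∀ {p q} → q < p → (p ≤ᵇ q) ≡ false
  ≤ᵇ-false {p} {q} q<p with p ≤ᵇ q in e
  ... | false = refl
  ... | true  = ⊥-elim (<⇒≱ q<p (≤ᵇ-true⁻ e))

  +-cancelʳ-≤ : ∀ p q d → p + d ≤ q + d → p ≤ q
  +-cancelʳ-≤ p q d p+d≤q+d = begin
    p               ≡⟨ solve 2 (λ p d → p := (p :+ d) :- d) refl p d ⟩
    (p + d) - d     ≤⟨ +-monoˡ-≤ (- d) p+d≤q+d ⟩
    (q + d) - d     ≡⟨ solve 2 (λ q d → (q :+ d) :- d := q) refl q d ⟩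
    q               ∎
    where open ≤-Reasoning

module Folds where

  open +-*-Solver
  open import Data.Fin.Subset using (inside; outside; _∪_; _∩_)
  open import Data.Vec.Properties using (lookup-zipWith)
  open import Data.List.Membership.Propositional using (_∈_)
  open import Data.List.Membership.Propositional.Properties using (∈-++⁺ˡ; ∈-++⁺ʳ; ∈-map⁺)
  open import Data.List.Relation.Unary.All using (All; []; _∷_)

  private variable
    B : Set

  ∧-≡true : ∀ {x y} → x ∧ y ≡ true → x ≡ true × y ≡ true
  ∧-≡true {true} {true} _ = refl , refl

  ∨-≡true : ∀ {x y} → x ∨ y ≡ true → x ≡ true ⊎ y ≡ true
  ∨-≡true {true}  _ = inj₁ refl
  ∨-≡true {false} e = inj₂ e

  ≡true-ext : ∀ {x y : Bool} → (x ≡ true → y ≡ true) → (y ≡ true → x ≡ true) → x ≡ y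
  ≡true-ext {true}  {true}  _ _ = refl
  ≡true-ext {true}  {false} f _ = sym (f refl)
  ≡true-ext {false} {true}  _ g = g refl
  ≡true-ext {false} {false} _ _ = refl

  sumBy : (B → ℚ) → List B → ℚ
  sumBy f = foldr (λ x acc → f x + acc) 0ℚ

  sumBy-++ : (f : B → ℚ) (xs ys : List B) → sumBy f (xs ++ ys) ≡ sumBy f xs + sumBy f ys
  sumBy-++ f []       ys = sym (+-identityˡ _)
  sumBy-++ f (x ∷ xs) ys rewrite sumBy-++ f xs ys = sym (+-assoc (f x) (sumBy f xs) (sumBy f ys))

  sumBy-+ : (f g : B → ℚ) (xs : List B) → sumBy (λ x → f x + g x) xs ≡ sumBy f xs + sumBy g xs
  sumBy-+ f g []       = sym (+-identityˡ 0ℚ)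
  sumBy-+ f g (x ∷ xs) rewrite sumBy-+ f g xs =
    solve 4 (λ a b c d → (a :+ b) :+ (c :+ d) := (a :+ c) :+ (b :+ d)) refl (f x) (g x) (sumBy f xs) (sumBy g xs)

  sumBy-congᴬ : (f g : B → ℚ) (xs : List B) → All (λ x → f x ≡ g x) xs → sumBy f xs ≡ sumBy g xs
  sumBy-congᴬ f g []       []       = refl
  sumBy-congᴬ f g (x ∷ xs) (e ∷ es) = cong₂ _+_ e (sumBy-congᴬ f g xs es)

  sumBy-cong : (f g : B → ℚ) (xs : List B) → (∀ x → f x ≡ g x) → sumBy f xs ≡ sumBy g xs
  sumBy-cong f g []       e = refl
  sumBy-cong f g (x ∷ xs) e = cong₂ _+_ (e x) (sumBy-cong f g xs e)

  sumBy-mono : (f g : B → ℚ) (xs : List B) → All (λ x → f x ≤ g x) xs → sumBy f xs ≤ sumBy g xs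
  sumBy-mono f g []       []       = ≤-refl
  sumBy-mono f g (x ∷ xs) (h ∷ hs) = +-mono-≤ h (sumBy-mono f g xs hs)

  sumBy-nonneg : (f : B → ℚ) (xs : List B) → (∀ x → 0ℚ ≤ f x) → 0ℚ ≤ sumBy f xs
  sumBy-nonneg f []       h = ≤-refl
  sumBy-nonneg f (x ∷ xs) h = begin
    0ℚ                 ≡⟨ sym (+-identityˡ 0ℚ) ⟩
    0ℚ + 0ℚ            ≤⟨ +-mono-≤ (h x) (sumBy-nonneg f xs h) ⟩
    f x + sumBy f xs   ∎
    where open ≤-Reasoning

  term≤sumBy : (f : B → ℚ) (xs : List B) → (∀ x → 0ℚ ≤ f x) → ∀ {x} → x ∈ xs → f x ≤ sumBy f xs
  term≤sumBy f (y ∷ xs) h (here refl) = begin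
    f y                ≡⟨ sym (+-identityʳ (f y)) ⟩
    f y + 0ℚ           ≤⟨ +-monoʳ-≤ (f y) (sumBy-nonneg f xs h) ⟩
    f y + sumBy f xs   ∎
    where open ≤-Reasoning
  term≤sumBy f (y ∷ xs) h {x} (there m) = begin
    f x                ≤⟨ term≤sumBy f xs h m ⟩
    sumBy f xs         ≡⟨ sym (+-identityˡ _) ⟩
    0ℚ + sumBy f xs    ≤⟨ +-monoˡ-≤ (sumBy f xs) (h y) ⟩
    f y + sumBy f xs   ∎
    where open ≤-Reasoning

  anyᵇ : (B → Bool) → List B → Bool
  anyᵇ p = foldr (λ x acc → p x ∨ acc) false

  anyᵇ-witness : (p : B → Bool) (xs : List B) → anyᵇ p xs ≡ true → Σ B (λ x → x ∈ xs × p x ≡ true)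
  anyᵇ-witness p (x ∷ xs) e with p x in px
  ... | true  = x , here refl , px
  ... | false with anyᵇ-witness p xs e
  ...   | y , m , py = y , there m , py

  anyᵇ-intro : (p : B → Bool) (xs : List B) {x : B} → x ∈ xs → p x ≡ true → anyᵇ p xs ≡ true
  anyᵇ-intro p (y ∷ xs) (here refl) px rewrite px = refl
  anyᵇ-intro p (y ∷ xs) (there m)   px rewrite anyᵇ-intro p xs m px = ∨-zeroʳ (p y)

  anyᵇ-cong : (p q : B → Bool) (xs : List B) → (∀ x → p x ≡ q x) → anyᵇ p xs ≡ anyᵇ q xs
  anyᵇ-cong p q []       h = refl
  anyᵇ-cong p q (x ∷ xs) h = cong₂ _∨_ (h x) (anyᵇ-cong p q xs h)

  allᵇ-elim : (p : B → Bool) (xs : List B) → allᵇ p xs ≡ true → ∀ {x} → x ∈ xs → p x ≡ true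
  allᵇ-elim p (y ∷ xs) e (here refl) with p y | e
  ... | true | _ = refl
  allᵇ-elim p (y ∷ xs) e (there m) with p y | e
  ... | true | e' = allᵇ-elim p xs e' m

  allᵇ-intro : (p : B → Bool) (xs : List B) → (∀ x → p x ≡ true) → allᵇ p xs ≡ true
  allᵇ-intro p []       h = refl
  allᵇ-intro p (y ∷ xs) h rewrite h y = allᵇ-intro p xs h

  ∈-allSubsets : ∀ {m} (Y : Subset m) → Y ∈ allSubsets m
  ∈-allSubsets []                = here refl
  ∈-allSubsets {suc m} (false ∷ Y) = ∈-++⁺ˡ (∈-map⁺ (outside ∷_) (∈-allSubsets Y))
  ∈-allSubsets {suc m} (true ∷ Y)  = ∈-++⁺ʳ (map (outside ∷_) (allSubsets m)) (∈-map⁺ (inside ∷_) (∈-allSubsets Y))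

  sumOver-∪-∩ : ∀ {n} (Y₁ Y₂ : Subset n) (w : Fin n → ℚ) →
                sumOver (Y₁ ∪ Y₂) w + sumOver (Y₁ ∩ Y₂) w ≡ sumOver Y₁ w + sumOver Y₂ w
  sumOver-∪-∩ {n} Y₁ Y₂ w = begin
    sumOver (Y₁ ∪ Y₂) w + sumOver (Y₁ ∩ Y₂) w        ≡⟨ sym (sumBy-+ (weight (Y₁ ∪ Y₂)) (weight (Y₁ ∩ Y₂)) (allFin n)) ⟩
    sumBy (λ z → weight (Y₁ ∪ Y₂) z + weight (Y₁ ∩ Y₂) z) (allFin n) ≡⟨ sumBy-cong _ _ (allFin n) pointwise ⟩
    sumBy (λ z → weight Y₁ z + weight Y₂ z) (allFin n) ≡⟨ sumBy-+ (weight Y₁) (weight Y₂) (allFin n) ⟩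
    sumOver Y₁ w + sumOver Y₂ w                      ∎
    where
      open ≡-Reasoning
      weight : Subset n → Fin n → ℚ
      weight Y z = if lookup Y z then w z else 0ℚ
      pointwise : ∀ z → weight (Y₁ ∪ Y₂) z + weight (Y₁ ∩ Y₂) z ≡ weight Y₁ z + weight Y₂ z
      pointwise z rewrite lookup-zipWith _∨_ z Y₁ Y₂ | lookup-zipWith _∧_ z Y₁ Y₂ with lookup Y₁ z | lookup Y₂ z
      ... | true  | true  = refl
      ... | true  | false = refl
      ... | false | true  = +-comm (w z) 0ℚ
      ... | false | false = refl

module Measure where

  open import Data.List.Membership.Propositional using (_∈_)
  open import Data.List.Membership.Propositional.Properties using (∈-++⁺ˡ; ∈-++⁺ʳ; ∈-++⁻)
  open import Data.List.Relation.Unary.Linked as Linked using (Linked; _∷_)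
  open import Data.List.Relation.Binary.Permutation.Propositional using (_↭_; ↭-sym; ↭-trans; ↭-refl; ↭⇒↭ₛ; prep)
  open import Data.List.Relation.Binary.Permutation.Propositional.Properties using (∈-resp-↭; ++-comm)
  open import Data.List.Relation.Unary.Sorted.TotalOrder.Properties using (↗↭↗⇒≋)
  open import Data.List.Relation.Binary.Pointwise using (Pointwise-≡⇒≡)
  open import Data.List.Sort.Base using (SortingAlgorithm)
  open import Data.Sum using (fromInj₂)
  open import Relation.Binary.Bundles using (DecTotalOrder)
  open import Relation.Nullary.Decidable using (dec-true; dec-false)
  open import Data.List.Sort.InsertionSort.Base ≤-decTotalOrder using (insert)
  open import Data.List.Sort.InsertionSort.Properties ≤-decTotalOrder using (insert-↗; insert-↭)
  open import Data.List.Sort.MergeSort ≤-decTotalOrder using (mergeSort)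

  open OrderFacts
  open +-*-Solver
  open Folds using (anyᵇ; ∧-≡true)

  Sorted : List ℚ → Set
  Sorted = Linked _≤_

  head≤ : ∀ {z zs e} → Sorted (z ∷ zs) → e ∈ z ∷ zs → z ≤ e
  head≤ _         (here refl) = ≤-refl
  head≤ (z≤ ∷ zs↗) (there m)  = ≤-trans z≤ (head≤ zs↗ m)

  ConstantBetween : List ℚ → (ℚ → Bool) → Set
  ConstantBetween E χ = ∀ x y → x ≤ y → (∀ e → e ∈ E → e ≤ x ⊎ y < e) → χ x ≡ χ y

  EmptyBelow : List ℚ → (ℚ → Bool) → Set
  EmptyBelow E χ = ∀ x → (∀ e → e ∈ E → x < e) → χ x ≡ false

  EmptyAbove : List ℚ → (ℚ → Bool) → Set
  EmptyAbove E χ = ∀ x → (∀ e → e ∈ E → e ≤ x) → χ x ≡ false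

  ≤ᵇ-constant : ∀ e x y → x ≤ y → e ≤ x ⊎ y < e → (e ≤ᵇ x) ≡ (e ≤ᵇ y)
  ≤ᵇ-constant e x y x≤y (inj₁ e≤x) = trans (≤ᵇ-true e≤x) (sym (≤ᵇ-true (≤-trans e≤x x≤y)))
  ≤ᵇ-constant e x y x≤y (inj₂ y<e) = trans (≤ᵇ-false (≤-<-trans x≤y y<e)) (sym (≤ᵇ-false y<e))

  memᴿ-constant : ∀ r → ConstantBetween (endsᴿ r) (memᴿ r)
  memᴿ-constant ∅ᴿ x y _ _ = refl
  memᴿ-constant (ival a b) x y x≤y H =
    cong₂ (λ p q → p ∧ not q) (≤ᵇ-constant a x y x≤y (H a (here refl)))
                              (≤ᵇ-constant b x y x≤y (H b (there (here refl))))
  memᴿ-constant (r ∪ᴿ s) x y x≤y H =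
    cong₂ _∨_ (memᴿ-constant r x y x≤y (λ e m → H e (∈-++⁺ˡ m)))
              (memᴿ-constant s x y x≤y (λ e m → H e (∈-++⁺ʳ (endsᴿ r) m)))
  memᴿ-constant (r ∖ᴿ s) x y x≤y H =
    cong₂ (λ p q → p ∧ not q) (memᴿ-constant r x y x≤y (λ e m → H e (∈-++⁺ˡ m)))
                              (memᴿ-constant s x y x≤y (λ e m → H e (∈-++⁺ʳ (endsᴿ r) m)))

  memᴿ-below : ∀ r → EmptyBelow (endsᴿ r) (memᴿ r)
  memᴿ-below ∅ᴿ x _ = refl
  memᴿ-below (ival a b) x H rewrite ≤ᵇ-false {a} {x} (H a (here refl)) = refl
  memᴿ-below (r ∪ᴿ s) x H
    rewrite memᴿ-below r x (λ e m → H e (∈-++⁺ˡ m)) | memᴿ-below s x (λ e m → H e (∈-++⁺ʳ (endsᴿ r) m)) = refl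
  memᴿ-below (r ∖ᴿ s) x H rewrite memᴿ-below r x (λ e m → H e (∈-++⁺ˡ m)) = refl

  memᴿ-above : ∀ r → EmptyAbove (endsᴿ r) (memᴿ r)
  memᴿ-above ∅ᴿ x _ = refl
  memᴿ-above (ival a b) x H rewrite ≤ᵇ-true {b} {x} (H b (there (here refl))) = ∧-zeroʳ _
  memᴿ-above (r ∪ᴿ s) x H
    rewrite memᴿ-above r x (λ e m → H e (∈-++⁺ˡ m)) | memᴿ-above s x (λ e m → H e (∈-++⁺ʳ (endsᴿ r) m)) = refl
  memᴿ-above (r ∖ᴿ s) x H rewrite memᴿ-above r x (λ e m → H e (∈-++⁺ˡ m)) = refl

  insert-≤ : ∀ {x y ys} → x ≤ y → insert x (y ∷ ys) ≡ x ∷ y ∷ ys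
  insert-≤ {x} {y} {ys} h = cong (λ b → if b then x ∷ y ∷ ys else y ∷ insert x ys) (dec-true (x ≤? y) h)

  insert-≰ : ∀ {x y ys} → ¬ (x ≤ y) → insert x (y ∷ ys) ≡ y ∷ insert x ys
  insert-≰ {x} {y} {ys} h = cong (λ b → if b then x ∷ y ∷ ys else y ∷ insert x ys) (dec-false (x ≤? y) h)

  insertAll : List ℚ → List ℚ → List ℚ
  insertAll xs M = foldr insert M xs

  insertAll-↗ : ∀ xs M → Sorted M → Sorted (insertAll xs M)
  insertAll-↗ []       M s = s
  insertAll-↗ (x ∷ xs) M s = insert-↗ x (insertAll-↗ xs M s)

  insertAll-↭ : ∀ xs M → insertAll xs M ↭ xs ++ M
  insertAll-↭ []       M = ↭-refl
  insertAll-↭ (x ∷ xs) M = ↭-trans (insert-↭ x (insertAll xs M)) (prep x (insertAll-↭ xs M))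

  empty-step : ∀ (b : Bool) z → (if b then z - z else 0ℚ) ≡ 0ℚ
  empty-step true  z = +-inverseʳ z
  empty-step false z = refl

  -- Refining the partition of the line by further points does not change a step sum, as long as χ
  -- is constant between the points of E, E lies in the partition and χ vanishes outside it.
  module Refinement (E : List ℚ) (χ : ℚ → Bool)
    (const : ConstantBetween E χ) (below : EmptyBelow E χ) (above : EmptyAbove E χ) where

    separated : ∀ {y z zs x} → Sorted (y ∷ z ∷ zs) → (∀ e → e ∈ E → e ∈ z ∷ zs ⊎ e ≤ y) → x < z →
                ∀ e → e ∈ E → e ≤ y ⊎ x < e
    separated s C x<z e m with C e m
    ... | inj₂ e≤y = inj₁ e≤y
    ... | inj₁ q   = inj₂ (<-≤-trans x<z (head≤ (Linked.tail s) q))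

    stepSum-split : ∀ y z zs x → Sorted (y ∷ z ∷ zs) → y < x → x ≤ z →
                    (∀ e → e ∈ E → e ∈ z ∷ zs ⊎ e ≤ y) →
                    stepSum χ (y ∷ x ∷ z ∷ zs) ≡ stepSum χ (y ∷ z ∷ zs)
    stepSum-split y z zs x s y<x x≤z C with ≤⇒<⊎≡ x≤z
    ... | inj₂ refl rewrite empty-step (χ x) x | +-identityˡ (stepSum χ (x ∷ zs)) = refl
    ... | inj₁ x<z rewrite const y x (<⇒≤ y<x) (separated s C x<z) with χ x
    ...   | true  = solve 4 (λ x y z S → (x :- y) :+ ((z :- x) :+ S) := (z :- y) :+ S) refl x y z (stepSum χ (z ∷ zs))
    ...   | false = cong (0ℚ +_) (+-identityˡ (stepSum χ (z ∷ zs)))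

    stepSum-insert-after : ∀ y ys x → Sorted (y ∷ ys) → y < x → (∀ e → e ∈ E → e ∈ ys ⊎ e ≤ y) →
                           stepSum χ (y ∷ insert x ys) ≡ stepSum χ (y ∷ ys)
    stepSum-insert-after y [] x s y<x C rewrite above y (λ e m → fromInj₂ (λ ()) (C e m)) = +-identityˡ 0ℚ
    stepSum-insert-after y (z ∷ zs) x s y<x C with x ≤? z
    ... | yes x≤z rewrite insert-≤ {x} {z} {zs} x≤z = stepSum-split y z zs x s y<x x≤z C
    ... | no x≰z rewrite insert-≰ {x} {z} {zs} x≰z =
          cong ((if χ y then z - y else 0ℚ) +_) (stepSum-insert-after z zs x (Linked.tail s) (≰⇒> x≰z) C')
      where
        C' : ∀ e → e ∈ E → e ∈ zs ⊎ e ≤ z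
        C' e m with C e m
        ... | inj₁ (here refl) = inj₂ ≤-refl
        ... | inj₁ (there q)   = inj₁ q
        ... | inj₂ e≤y         = inj₂ (≤-trans e≤y (Linked.head s))

    stepSum-insert : ∀ M x → Sorted M → (∀ e → e ∈ E → e ∈ M) → stepSum χ (insert x M) ≡ stepSum χ M
    stepSum-insert []       x _ _ = refl
    stepSum-insert (y ∷ ys) x s C with x ≤? y
    ... | no x≰y rewrite insert-≰ {x} {y} {ys} x≰y = stepSum-insert-after y ys x s (≰⇒> x≰y) C'
      where
        C' : ∀ e → e ∈ E → e ∈ ys ⊎ e ≤ y
        C' e m with C e m
        ... | here refl = inj₂ ≤-refl
        ... | there q   = inj₁ q
    ... | yes x≤y rewrite insert-≤ {x} {y} {ys} x≤y with ≤⇒<⊎≡ x≤y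
    ...   | inj₂ refl rewrite empty-step (χ x) x = +-identityˡ _
    ...   | inj₁ x<y rewrite below x (λ e m → <-≤-trans x<y (head≤ s (C e m))) = +-identityˡ _

    stepSum-insertAll : ∀ xs M → Sorted M → (∀ e → e ∈ E → e ∈ M) →
                        stepSum χ (insertAll xs M) ≡ stepSum χ M
    stepSum-insertAll []       M s C = refl
    stepSum-insertAll (x ∷ xs) M s C =
      trans (stepSum-insert (insertAll xs M) x (insertAll-↗ xs M s)
              (λ e m → ∈-resp-↭ (↭-sym (insertAll-↭ xs M)) (∈-++⁺ʳ xs (C e m))))
            (stepSum-insertAll xs M s C)

  -- both sides are the step sum over the sorted merge of L and the endpoints of r
  measure≡stepSum : ∀ r L → Sorted L → (∀ e → e ∈ endsᴿ r → e ∈ L) → measure r ≡ stepSum (memᴿ r) L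
  measure≡stepSum r L L↗ C = begin
      stepSum χ s               ≡⟨ sym (stepSum-insertAll L s s↗ (λ e m → ∈-resp-↭ (↭-sym s↭) m)) ⟩
      stepSum χ (insertAll L s) ≡⟨ cong (stepSum χ) merged-equal ⟩
      stepSum χ (insertAll s L) ≡⟨ stepSum-insertAll s L L↗ C ⟩
      stepSum χ L               ∎
    where
      open ≡-Reasoning
      χ = memᴿ r
      open Refinement (endsᴿ r) χ (memᴿ-constant r) (memᴿ-below r) (memᴿ-above r)
      open SortingAlgorithm mergeSort using (sort; sort-↗; sort-↭)
      s = sort (endsᴿ r)
      s↗ = sort-↗ (endsᴿ r)
      s↭ = sort-↭ (endsᴿ r)
      merged-↭ : insertAll L s ↭ insertAll s L
      merged-↭ = ↭-trans (insertAll-↭ L s) (↭-trans (++-comm L s) (↭-sym (insertAll-↭ s L)))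
      merged-equal : insertAll L s ≡ insertAll s L
      merged-equal = Pointwise-≡⇒≡ (↗↭↗⇒≋ (DecTotalOrder.totalOrder ≤-decTotalOrder)
                       (insertAll-↗ L s s↗) (insertAll-↗ s L L↗) (↭⇒↭ₛ merged-↭))

  memᴿ-⋃ᴿ-map : ∀ {B : Set} (f : B → Region) xs x → memᴿ (⋃ᴿ (map f xs)) x ≡ anyᵇ (λ z → memᴿ (f z) x) xs
  memᴿ-⋃ᴿ-map f []       x = refl
  memᴿ-⋃ᴿ-map f (z ∷ xs) x = cong (memᴿ (f z) x ∨_) (memᴿ-⋃ᴿ-map f xs x)

  endsᴿ-⋃ᴿ-map⁻ : ∀ {B : Set} (f : B → Region) xs {e} → e ∈ endsᴿ (⋃ᴿ (map f xs)) →
                  Σ B (λ z → z ∈ xs × e ∈ endsᴿ (f z))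
  endsᴿ-⋃ᴿ-map⁻ f (z ∷ xs) m with ∈-++⁻ (endsᴿ (f z)) m
  ... | inj₁ q = z , here refl , q
  ... | inj₂ q with endsᴿ-⋃ᴿ-map⁻ f xs q
  ...   | y , y∈xs , r = y , there y∈xs , r

  endsᴿ-⋃ᴿ-map⁺ : ∀ {B : Set} (f : B → Region) xs {e z} → z ∈ xs → e ∈ endsᴿ (f z) → e ∈ endsᴿ (⋃ᴿ (map f xs))
  endsᴿ-⋃ᴿ-map⁺ f (y ∷ xs) (here refl) m = ∈-++⁺ˡ m
  endsᴿ-⋃ᴿ-map⁺ f (y ∷ xs) (there z∈xs) m = ∈-++⁺ʳ (endsᴿ (f y)) (endsᴿ-⋃ᴿ-map⁺ f xs z∈xs m)

  memᴿ-ival⁻ : ∀ a b x → memᴿ (ival a b) x ≡ true → a ≤ x × x < b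
  memᴿ-ival⁻ a b x e with ∧-≡true {a ≤ᵇ x} e
  ... | a≤x , x≱b = ≤ᵇ-true⁻ a≤x , ≰⇒> (λ b≤x → contradiction (trans (sym x≱b) (cong not (≤ᵇ-true b≤x))) λ ())

  memᴿ-ival⁺ : ∀ a b x → a ≤ x → x < b → memᴿ (ival a b) x ≡ true
  memᴿ-ival⁺ a b x a≤x x<b rewrite ≤ᵇ-true a≤x | ≤ᵇ-false {b} {x} x<b = refl

module Splitting {n : ℕ} (X : Subset n) (w : Fin n → ℚ) (k : ℚ) (Pts : List ℚ)
  (Consistent : ℚ → ℚ → (Fin n → Bool) → Subset n → Set)
  (Consistent-mono : ∀ {a b U S a' b' U'} → Consistent a b U S → a ≤ a' → b' ≤ b →
                     (∀ z → U' z ≡ true → U z ≡ true) → Consistent a' b' U' S) where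

  -- Consistent is any invariant of cells that survives shrinking the interval and the set of users.

  open import Data.Fin.Subset using (_∪_; _∩_)
  open import Data.List.Membership.Propositional using (_∈_)
  open import Relation.Binary.Bundles using (DecTotalOrder)
  open import Data.List.Extrema (DecTotalOrder.totalOrder ≤-decTotalOrder) using (min; min≤⊤; min≤xs; argmin-all)
  open import Data.List.Membership.Propositional.Properties using (∈-map⁺; ∈-allFin)
  open import Data.List.Properties using (++-assoc; ++-identityʳ)
  open import Data.List.Relation.Unary.All as All using (All; []; _∷_)
  import Data.List.Relation.Unary.All.Properties as All
  open import Data.Vec.Properties using (lookup-zipWith)
  open Folds
  open OrderFacts
  open +-*-Solver
  open import Data.List.Relation.Unary.Linked using ([-]; _∷_)
  open Measure using (Sorted)

  record Cell : Set where
    constructor cell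
    field
      lo hi    : ℚ
      users    : Fin n → Bool
      oldClass : Subset n
  open Cell public

  len : Cell → ℚ
  len c = hi c - lo c

  len≥0 : ∀ c → lo c ≤ hi c → 0ℚ ≤ len c
  len≥0 c lo≤hi = begin
    0ℚ             ≡⟨ sym (+-inverseʳ (lo c)) ⟩
    lo c - lo c    ≤⟨ +-monoˡ-≤ (- lo c) lo≤hi ⟩
    hi c - lo c    ∎
    where open ≤-Reasoning

  _⊆ᵘ_ : (Fin n → Bool) → (Fin n → Bool) → Set
  U ⊆ᵘ U' = ∀ z → U z ≡ true → U' z ≡ true

  without : Fin n → (Fin n → Bool) → Fin n → Bool
  without u U z = U z ∧ not (does (z ≟ u))

  without-⊆ : ∀ u U → without u U ⊆ᵘ U
  without-⊆ u U z e with U z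
  ... | true  = refl
  ... | false = e

  without-self : ∀ u U → without u U u ≡ false
  without-self u U with u ≟ u
  ... | yes _  = ∧-zeroʳ (U u)
  ... | no u≢u = contradiction refl u≢u

  without-other : ∀ u U z → z ≢ u → U z ≡ true → without u U z ≡ true
  without-other u U z z≢u e with z ≟ u
  ... | yes z≡u = contradiction z≡u z≢u
  ... | no _ rewrite e = refl

  meets : Subset n → (Fin n → Bool) → Bool
  meets Y U = anyᵇ (λ z → lookup Y z ∧ U z) (allFin n)

  meets-witness : ∀ Y U → meets Y U ≡ true → Σ (Fin n) (λ z → lookup Y z ≡ true × U z ≡ true)
  meets-witness Y U e with anyᵇ-witness _ (allFin n) e
  ... | z , _ , p = z , ∧-≡true p

  meets-intro : ∀ Y U z → lookup Y z ≡ true → U z ≡ true → meets Y U ≡ true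
  meets-intro Y U z yz uz = anyᵇ-intro _ (allFin n) (∈-allFin z) (cong₂ _∧_ yz uz)

  meets-mono : ∀ Y {U U'} → U ⊆ᵘ U' → meets Y U ≡ true → meets Y U' ≡ true
  meets-mono Y U⊆U' e with meets-witness Y _ e
  ... | z , yz , uz = meets-intro Y _ z yz (U⊆U' z uz)

  ¬meets-mono : ∀ Y {U U'} → U ⊆ᵘ U' → meets Y U' ≡ false → meets Y U ≡ false
  ¬meets-mono Y {U} U⊆U' e with meets Y U in e'
  ... | false = refl
  ... | true  = trans (sym (meets-mono Y U⊆U' e')) e

  meets-only : ∀ Y U u → meets Y U ≡ true → meets Y (without u U) ≡ false → lookup Y u ≡ true × U u ≡ true
  meets-only Y U u e f with meets-witness Y U e
  ... | z , yz , uz with z ≟ u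
  ...   | yes refl = yz , uz
  ...   | no z≢u  = contradiction (trans (sym (meets-intro Y (without u U) z yz (without-other u U z z≢u uz))) f) λ ()

  meets-∪⁻ : ∀ Y₁ Y₂ U → meets (Y₁ ∪ Y₂) U ≡ true → meets Y₁ U ≡ true ⊎ meets Y₂ U ≡ true
  meets-∪⁻ Y₁ Y₂ U e with meets-witness (Y₁ ∪ Y₂) U e
  ... | z , yz , uz with ∨-≡true (trans (sym (lookup-zipWith _∨_ z Y₁ Y₂)) yz)
  ...   | inj₁ y₁z = inj₁ (meets-intro Y₁ U z y₁z uz)
  ...   | inj₂ y₂z = inj₂ (meets-intro Y₂ U z y₂z uz)

  meets-∪ˡ : ∀ Y₁ Y₂ U → meets Y₁ U ≡ true → meets (Y₁ ∪ Y₂) U ≡ true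
  meets-∪ˡ Y₁ Y₂ U e with meets-witness Y₁ U e
  ... | z , yz , uz = meets-intro (Y₁ ∪ Y₂) U z (trans (lookup-zipWith _∨_ z Y₁ Y₂) (cong (_∨ lookup Y₂ z) yz)) uz

  meets-∩⁻ : ∀ Y₁ Y₂ U → meets (Y₁ ∩ Y₂) U ≡ true → meets Y₁ U ≡ true × meets Y₂ U ≡ true
  meets-∩⁻ Y₁ Y₂ U e with meets-witness (Y₁ ∩ Y₂) U e
  ... | z , yz , uz with ∧-≡true (trans (sym (lookup-zipWith _∧_ z Y₁ Y₂)) yz)
  ...   | y₁z , y₂z = meets-intro Y₁ U z y₁z uz , meets-intro Y₂ U z y₂z uz

  supply : Subset n → Cell → ℚ
  supply Y c = if meets Y (users c) then len c else 0ℚ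

  totalSupply : Subset n → List Cell → ℚ
  totalSupply Y = sumBy (supply Y)

  if-submodular : ∀ (l : ℚ) → 0ℚ ≤ l → ∀ b₁ b₂ b∪ b∩ → (b∪ ≡ true → b₁ ≡ true ⊎ b₂ ≡ true) →
    (b∩ ≡ true → b₁ ≡ true) → (b∩ ≡ true → b₂ ≡ true) →
    (if b∪ then l else 0ℚ) + (if b∩ then l else 0ℚ) ≤ (if b₁ then l else 0ℚ) + (if b₂ then l else 0ℚ)
  if-submodular l l≥0 true  true  true  true  _ _ _ = ≤-refl
  if-submodular l l≥0 true  true  true  false _ _ _ = +-monoʳ-≤ l l≥0
  if-submodular l l≥0 true  true  false true  _ _ _ = +-monoˡ-≤ l l≥0
  if-submodular l l≥0 true  true  false false _ _ _ = +-mono-≤ l≥0 l≥0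
  if-submodular l l≥0 true  false true  false _ _ _ = ≤-refl
  if-submodular l l≥0 true  false false false _ _ _ = +-monoˡ-≤ 0ℚ l≥0
  if-submodular l l≥0 false true  true  false _ _ _ = ≤-reflexive (+-comm l 0ℚ)
  if-submodular l l≥0 false true  false false _ _ _ = +-monoʳ-≤ 0ℚ l≥0
  if-submodular l l≥0 false false false false _ _ _ = ≤-refl
  if-submodular l l≥0 false false true  _     h _ _ with h refl
  ... | inj₁ ()
  ... | inj₂ ()
  if-submodular l l≥0 true  false _     true  _ _ h with h refl
  ... | ()
  if-submodular l l≥0 false true  _     true  _ h _ with h refl
  ... | ()
  if-submodular l l≥0 false false false true  _ h _ with h refl
  ... | ()

  supply-submodular : ∀ Y₁ Y₂ c → lo c ≤ hi c →
    supply (Y₁ ∪ Y₂) c + supply (Y₁ ∩ Y₂) c ≤ supply Y₁ c + supply Y₂ c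
  supply-submodular Y₁ Y₂ c lo≤hi =
    if-submodular (len c) (len≥0 c lo≤hi) (meets Y₁ U) (meets Y₂ U) (meets (Y₁ ∪ Y₂) U) (meets (Y₁ ∩ Y₂) U)
      (meets-∪⁻ Y₁ Y₂ U) (λ e → proj₁ (meets-∩⁻ Y₁ Y₂ U e)) (λ e → proj₂ (meets-∩⁻ Y₁ Y₂ U e))
    where U = users c

  totalSupply-submodular : ∀ Y₁ Y₂ cs → All (λ c → lo c ≤ hi c) cs →
    totalSupply (Y₁ ∪ Y₂) cs + totalSupply (Y₁ ∩ Y₂) cs ≤ totalSupply Y₁ cs + totalSupply Y₂ cs
  totalSupply-submodular Y₁ Y₂ cs ok = begin
    totalSupply (Y₁ ∪ Y₂) cs + totalSupply (Y₁ ∩ Y₂) cs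
      ≡⟨ sym (sumBy-+ (supply (Y₁ ∪ Y₂)) (supply (Y₁ ∩ Y₂)) cs) ⟩
    sumBy (λ c → supply (Y₁ ∪ Y₂) c + supply (Y₁ ∩ Y₂) c) cs
      ≤⟨ sumBy-mono _ _ cs (All.map (λ {c} → supply-submodular Y₁ Y₂ c) ok) ⟩
    sumBy (λ c → supply Y₁ c + supply Y₂ c) cs
      ≡⟨ sumBy-+ (supply Y₁) (supply Y₂) cs ⟩
    totalSupply Y₁ cs + totalSupply Y₂ cs ∎
    where open ≤-Reasoning

  totalSupply-focus : ∀ Y pre c rest →
    totalSupply Y (pre ++ c ∷ rest) ≡ totalSupply Y (pre ++ rest) + supply Y c
  totalSupply-focus Y pre c rest = begin
    totalSupply Y (pre ++ c ∷ rest)       ≡⟨ sumBy-++ (supply Y) pre (c ∷ rest) ⟩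
    P + (supply Y c + R)                  ≡⟨ solve 3 (λ p s r → p :+ (s :+ r) := (p :+ r) :+ s) refl P (supply Y c) R ⟩
    (P + R) + supply Y c                  ≡⟨ cong (_+ supply Y c) (sym (sumBy-++ (supply Y) pre rest)) ⟩
    totalSupply Y (pre ++ rest) + supply Y c ∎
    where
      open ≡-Reasoning
      P = totalSupply Y pre
      R = totalSupply Y rest

  _⊆X : Subset n → Set
  Y ⊆X = ∀ z → lookup Y z ≡ true → lookup X z ≡ true

  ⊆Xᵇ : Subset n → Bool
  ⊆Xᵇ Y = allᵇ (λ z → not (lookup Y z) ∨ lookup X z) (allFin n)

  ⊆Xᵇ-sound : ∀ Y → ⊆Xᵇ Y ≡ true → Y ⊆X
  ⊆Xᵇ-sound Y e z yz with allᵇ-elim _ (allFin n) e (∈-allFin z)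
  ... | q rewrite yz = q

  ⊆Xᵇ-complete : ∀ Y → Y ⊆X → ⊆Xᵇ Y ≡ true
  ⊆Xᵇ-complete Y Y⊆X = allᵇ-intro _ (allFin n) pointwise
    where
      pointwise : ∀ z → (not (lookup Y z) ∨ lookup X z) ≡ true
      pointwise z with lookup Y z in yz
      ... | false = refl
      ... | true  = Y⊆X z yz

  Hall : List Cell → Set
  Hall cs = ∀ Y → Y ⊆X → sumOver Y w ≤ totalSupply Y cs

  record ValidCell (c : Cell) : Set where
    field
      ordered    : lo c ≤ hi c
      usersInX   : ∀ z → users c z ≡ true → lookup X z ≡ true
      consistent : Consistent (lo c) (hi c) (users c) (oldClass c)
  open ValidCell public

  Chain : ℚ → List Cell → ℚ → Set
  Chain p []       q = p ≡ q
  Chain p (c ∷ cs) q = lo c ≡ p × Chain (hi c) cs q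

  boundaries : ℚ → List Cell → List ℚ
  boundaries p cs = p ∷ map hi cs

  record Admissible (cs : List Cell) : Set where
    field
      chain    : Chain 0ℚ cs k
      valid    : All ValidCell cs
      keepsPts : ∀ e → e ∈ Pts → e ∈ boundaries 0ℚ cs
      hall     : Hall cs
  open Admissible public

  All-focus : ∀ {P : Cell → Set} pre {c} rest → All P (pre ++ c ∷ rest) → P c × All P (pre ++ rest)
  All-focus pre rest ps with All.++⁻ pre ps
  ... | ps-pre , (pc ∷ ps-rest) = pc , All.++⁺ ps-pre ps-rest

  module Split (pre : List Cell) (c : Cell) (rest : List Cell) (u v : Fin n)
    (adm : Admissible (pre ++ c ∷ rest)) (u≢v : u ≢ v) (u-uses : users c u ≡ true) (v-uses : users c v ≡ true) where

    cs₀ others : List Cell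
    cs₀    = pre ++ c ∷ rest
    others = pre ++ rest

    valid-c : ValidCell c
    valid-c = proj₁ (All-focus pre rest (valid adm))

    ordered-others : All (λ d → lo d ≤ hi d) others
    ordered-others = All.map ordered (proj₂ (All-focus pre rest (valid adm)))

    -- removing x from the users of c costs such a Y its whole supply from c
    onlyThrough : Fin n → Subset n → Bool
    onlyThrough x Y = ⊆Xᵇ Y ∧ (lookup Y x ∧ not (meets Y (without x (users c))))

    onlyThrough⁻ : ∀ x Y → onlyThrough x Y ≡ true →
                   Y ⊆X × lookup Y x ≡ true × meets Y (without x (users c)) ≡ false
    onlyThrough⁻ x Y e with ⊆Xᵇ Y in e₁ | lookup Y x in e₂ | meets Y (without x (users c)) in e₃
    onlyThrough⁻ x Y refl | true | true | false = ⊆Xᵇ-sound Y e₁ , refl , refl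

    onlyThrough⁺ : ∀ x Y → Y ⊆X → lookup Y x ≡ true → meets Y (without x (users c)) ≡ false → onlyThrough x Y ≡ true
    onlyThrough⁺ x Y Y⊆X e₂ e₃ rewrite ⊆Xᵇ-complete Y Y⊆X | e₂ | e₃ = refl

    slack : Subset n → ℚ
    slack Y = totalSupply Y cs₀ - sumOver Y w

    slack≥0 : ∀ Y → Y ⊆X → 0ℚ ≤ slack Y
    slack≥0 Y Y⊆X = begin
      0ℚ                                    ≡⟨ sym (+-inverseʳ (sumOver Y w)) ⟩
      sumOver Y w - sumOver Y w             ≤⟨ +-monoˡ-≤ (- sumOver Y w) (hall adm Y Y⊆X) ⟩
      slack Y                               ∎
      where open ≤-Reasoning

    slackThrough-u : Subset n → ℚ
    slackThrough-u Y = if onlyThrough u Y then slack Y else len c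

    -- the length of the right piece
    cut : ℚ
    cut = min (len c) (map slackThrough-u (allSubsets n))

    cut≤len : cut ≤ len c
    cut≤len = min≤⊤ (len c) (map slackThrough-u (allSubsets n))

    cut≤slack : ∀ Y → onlyThrough u Y ≡ true → cut ≤ slack Y
    cut≤slack Y e = subst (cut ≤_) (cong (λ b → if b then slack Y else len c) e)
      (All.lookup (min≤xs (len c) (map slackThrough-u (allSubsets n))) (∈-map⁺ slackThrough-u (∈-allSubsets Y)))

    CutAttained : ℚ → Set
    CutAttained t = t ≡ len c ⊎ Σ (Subset n) (λ Y → onlyThrough u Y ≡ true × t ≡ slack Y)

    cut-attained : CutAttained cut
    cut-attained = argmin-all (λ t → t) {P = CutAttained} (inj₁ refl) (All.map⁺ (All.universal attained (allSubsets n)))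
      where
        attained : ∀ Y → CutAttained (slackThrough-u Y)
        attained Y with onlyThrough u Y in e
        ... | true  = inj₂ (Y , e , refl)
        ... | false = inj₁ refl

    cut≥0 : 0ℚ ≤ cut
    cut≥0 with cut-attained
    ... | inj₁ e             = subst (0ℚ ≤_) (sym e) (len≥0 c (ordered valid-c))
    ... | inj₂ (Y , tight , e) = subst (0ℚ ≤_) (sym e) (slack≥0 Y (proj₁ (onlyThrough⁻ u Y tight)))

    left right : Cell
    left  = cell (lo c) (hi c - cut) (without v (users c)) (oldClass c)
    right = cell (hi c - cut) (hi c) (without u (users c)) (oldClass c)

    supply-meets : ∀ Y d → meets Y (users d) ≡ true → supply Y d ≡ len d
    supply-meets Y d e rewrite e = refl

    supply-¬meets : ∀ Y d → meets Y (users d) ≡ false → supply Y d ≡ 0ℚ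
    supply-¬meets Y d e rewrite e = refl

    ∪-⊆X : ∀ Y₁ Y₂ → Y₁ ⊆X → Y₂ ⊆X → (Y₁ ∪ Y₂) ⊆X
    ∪-⊆X Y₁ Y₂ h₁ h₂ z e with ∨-≡true (trans (sym (lookup-zipWith _∨_ z Y₁ Y₂)) e)
    ... | inj₁ e₁ = h₁ z e₁
    ... | inj₂ e₂ = h₂ z e₂

    ∩-⊆X : ∀ Y₁ Y₂ → Y₁ ⊆X → (Y₁ ∩ Y₂) ⊆X
    ∩-⊆X Y₁ Y₂ h₁ z e = h₁ z (proj₁ (∧-≡true (trans (sym (lookup-zipWith _∧_ z Y₁ Y₂)) e)))

    ∩-misses-c : ∀ Y₁ Y₂ → meets Y₁ (without u (users c)) ≡ false → meets Y₂ (without v (users c)) ≡ false →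
                 meets (Y₁ ∩ Y₂) (users c) ≡ false
    ∩-misses-c Y₁ Y₂ only₁ only₂ with meets (Y₁ ∩ Y₂) (users c) in e
    ... | false = refl
    ... | true with meets-witness (Y₁ ∩ Y₂) (users c) e
    ...   | z , z∈∩ , z-uses with ∧-≡true (trans (sym (lookup-zipWith _∧_ z Y₁ Y₂)) z∈∩) | z ≟ u | z ≟ v
    ...     | _ , _     | yes refl | yes refl = contradiction refl u≢v
    ...     | z∈Y₁ , _  | no z≢u   | _        =
              contradiction (trans (sym (meets-intro Y₁ _ z z∈Y₁ (without-other u (users c) z z≢u z-uses))) only₁) λ ()
    ...     | _ , z∈Y₂  | _        | no z≢v   =
              contradiction (trans (sym (meets-intro Y₂ _ z z∈Y₂ (without-other v (users c) z z≢v z-uses))) only₂) λ ()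

    -- Y₁ and Y₂ both reach c, but Y₁ ∩ Y₂ does not: this is where the split gains a full length of c.
    tight-pair : ∀ Y₁ Y₂ → Y₁ ⊆X → Y₂ ⊆X →
      lookup Y₁ u ≡ true → meets Y₁ (without u (users c)) ≡ false →
      lookup Y₂ v ≡ true → meets Y₂ (without v (users c)) ≡ false →
      (sumOver Y₁ w + sumOver Y₂ w) + len c ≤ totalSupply Y₁ cs₀ + totalSupply Y₂ cs₀
    tight-pair Y₁ Y₂ h₁ h₂ u∈Y₁ only₁ v∈Y₂ only₂ = begin
      (sumOver Y₁ w + sumOver Y₂ w) + l
        ≡⟨ cong (_+ l) (sym (sumOver-∪-∩ Y₁ Y₂ w)) ⟩
      (sumOver (Y₁ ∪ Y₂) w + sumOver (Y₁ ∩ Y₂) w) + l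
        ≤⟨ +-monoˡ-≤ l (+-mono-≤ (hall adm (Y₁ ∪ Y₂) (∪-⊆X Y₁ Y₂ h₁ h₂)) (hall adm (Y₁ ∩ Y₂) (∩-⊆X Y₁ Y₂ h₁))) ⟩
      (totalSupply (Y₁ ∪ Y₂) cs₀ + totalSupply (Y₁ ∩ Y₂) cs₀) + l
        ≡⟨ cong₂ (λ p q → (p + q) + l)
             (trans (totalSupply-focus (Y₁ ∪ Y₂) pre c rest) (cong (TS∪ +_) (supply-meets (Y₁ ∪ Y₂) c meets-∪)))
             (trans (totalSupply-focus (Y₁ ∩ Y₂) pre c rest) (cong (TS∩ +_) (supply-¬meets (Y₁ ∩ Y₂) c (∩-misses-c Y₁ Y₂ only₁ only₂)))) ⟩
      ((TS∪ + l) + (TS∩ + 0ℚ)) + l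
        ≡⟨ solve 3 (λ p q l → ((p :+ l) :+ (q :+ con 0ℚ)) :+ l := (p :+ q) :+ (l :+ l)) refl TS∪ TS∩ l ⟩
      (TS∪ + TS∩) + (l + l)
        ≤⟨ +-monoˡ-≤ (l + l) (totalSupply-submodular Y₁ Y₂ others ordered-others) ⟩
      (TS₁ + TS₂) + (l + l)
        ≡⟨ solve 3 (λ p q l → (p :+ q) :+ (l :+ l) := (p :+ l) :+ (q :+ l)) refl TS₁ TS₂ l ⟩
      (TS₁ + l) + (TS₂ + l)
        ≡⟨ sym (cong₂ _+_
             (trans (totalSupply-focus Y₁ pre c rest) (cong (TS₁ +_) (supply-meets Y₁ c meets₁)))
             (trans (totalSupply-focus Y₂ pre c rest) (cong (TS₂ +_) (supply-meets Y₂ c meets₂)))) ⟩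
      totalSupply Y₁ cs₀ + totalSupply Y₂ cs₀ ∎
      where
        open ≤-Reasoning
        l   = len c
        TS∪ = totalSupply (Y₁ ∪ Y₂) others
        TS∩ = totalSupply (Y₁ ∩ Y₂) others
        TS₁ = totalSupply Y₁ others
        TS₂ = totalSupply Y₂ others
        meets₁ : meets Y₁ (users c) ≡ true
        meets₁ = meets-intro Y₁ (users c) u u∈Y₁ u-uses
        meets₂ : meets Y₂ (users c) ≡ true
        meets₂ = meets-intro Y₂ (users c) v v∈Y₂ v-uses
        meets-∪ : meets (Y₁ ∪ Y₂) (users c) ≡ true
        meets-∪ = meets-∪ˡ Y₁ Y₂ (users c) meets₁

    cs₁ : List Cell
    cs₁ = pre ++ left ∷ right ∷ rest

    -- d is what Y loses by the split
    hall-split : ∀ Y d → sumOver Y w + d ≤ totalSupply Y cs₀ →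
                 supply Y c ≡ (supply Y left + supply Y right) + d → sumOver Y w ≤ totalSupply Y cs₁
    hall-split Y d covered loss = +-cancelʳ-≤ (sumOver Y w) (totalSupply Y cs₁) d (begin
      sumOver Y w + d                               ≤⟨ covered ⟩
      totalSupply Y cs₀                             ≡⟨ totalSupply-focus Y pre c rest ⟩
      TS + supply Y c                               ≡⟨ cong (TS +_) loss ⟩
      TS + ((supply Y left + supply Y right) + d)   ≡⟨ solve 4 (λ p l r d → p :+ ((l :+ r) :+ d) := ((p :+ r) :+ l) :+ d)
                                                         refl TS (supply Y left) (supply Y right) d ⟩
      ((TS + supply Y right) + supply Y left) + d   ≡⟨ cong (_+ d) (sym (trans (totalSupply-focus Y pre left (right ∷ rest))
                                                         (cong (_+ supply Y left) (totalSupply-focus Y pre right rest)))) ⟩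
      totalSupply Y cs₁ + d                         ∎)
      where
        open ≤-Reasoning
        TS = totalSupply Y others

    no-loss : ∀ Y → Y ⊆X → supply Y c ≡ (supply Y left + supply Y right) + 0ℚ → sumOver Y w ≤ totalSupply Y cs₁
    no-loss Y Y⊆X = hall-split Y 0ℚ (subst (_≤ totalSupply Y cs₀) (sym (+-identityʳ _)) (hall adm Y Y⊆X))

    hall-through-u : ∀ Y → Y ⊆X → lookup Y u ≡ true → meets Y (without u (users c)) ≡ false →
                     sumOver Y w + cut ≤ totalSupply Y cs₀
    hall-through-u Y Y⊆X u∈Y only = begin
      sumOver Y w + cut                               ≤⟨ +-monoʳ-≤ (sumOver Y w) (cut≤slack Y (onlyThrough⁺ u Y Y⊆X u∈Y only)) ⟩
      sumOver Y w + (totalSupply Y cs₀ - sumOver Y w) ≡⟨ solve 2 (λ s x → s :+ (x :- s) := x) refl (sumOver Y w) (totalSupply Y cs₀) ⟩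
      totalSupply Y cs₀                               ∎
      where open ≤-Reasoning

    -- either the left piece is empty, or the tight set defining the cut pairs with Y in tight-pair
    hall-through-v : ∀ Y → Y ⊆X → lookup Y v ≡ true → meets Y (without v (users c)) ≡ false →
                     sumOver Y w + (len c - cut) ≤ totalSupply Y cs₀
    hall-through-v Y Y⊆X v∈Y only with cut-attained
    ... | inj₁ cut≡len = begin
      sumOver Y w + (len c - cut)   ≡⟨ cong (λ t → sumOver Y w + (len c - t)) cut≡len ⟩
      sumOver Y w + (len c - len c) ≡⟨ cong (sumOver Y w +_) (+-inverseʳ (len c)) ⟩
      sumOver Y w + 0ℚ              ≡⟨ +-identityʳ _ ⟩
      sumOver Y w                   ≤⟨ hall adm Y Y⊆X ⟩
      totalSupply Y cs₀             ∎
      where open ≤-Reasoning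
    ... | inj₂ (Y₁ , tight , cut≡slack) with onlyThrough⁻ u Y₁ tight
    ...   | Y₁⊆X , u∈Y₁ , only₁ = begin
      sumOver Y w + (len c - cut)                                      ≡⟨ cong (λ t → sumOver Y w + (len c - t)) cut≡slack ⟩
      sumOver Y w + (len c - (totalSupply Y₁ cs₀ - sumOver Y₁ w))      ≡⟨ solve 4 (λ s s₁ l p → s :+ (l :- (p :- s₁)) := ((s₁ :+ s) :+ l) :- p)
                                                                            refl (sumOver Y w) (sumOver Y₁ w) (len c) (totalSupply Y₁ cs₀) ⟩
      ((sumOver Y₁ w + sumOver Y w) + len c) - totalSupply Y₁ cs₀      ≤⟨ +-monoˡ-≤ (- totalSupply Y₁ cs₀) (tight-pair Y₁ Y Y₁⊆X Y⊆X u∈Y₁ only₁ v∈Y only) ⟩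
      (totalSupply Y₁ cs₀ + totalSupply Y cs₀) - totalSupply Y₁ cs₀    ≡⟨ solve 2 (λ p q → (p :+ q) :- p := q) refl (totalSupply Y₁ cs₀) (totalSupply Y cs₀) ⟩
      totalSupply Y cs₀                                                ∎
      where open ≤-Reasoning

    hall₁ : Hall cs₁
    hall₁ Y Y⊆X with meets Y (users c) in e | meets Y (without v (users c)) in e₁ | meets Y (without u (users c)) in e₂
    ... | false | e₁' | e₂' = no-loss Y Y⊆X loss
      where
        loss : supply Y c ≡ (supply Y left + supply Y right) + 0ℚ
        loss rewrite e | ¬meets-mono Y (without-⊆ v (users c)) e | ¬meets-mono Y (without-⊆ u (users c)) e = refl
    ... | true | true | true = no-loss Y Y⊆X loss
      where
        loss : supply Y c ≡ (supply Y left + supply Y right) + 0ℚ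
        loss rewrite e | e₁ | e₂ = solve 3 (λ a b t → b :- a := ((b :- t) :- a :+ (b :- (b :- t))) :+ con 0ℚ) refl (lo c) (hi c) cut
    ... | true | true | false =
          hall-split Y cut (hall-through-u Y Y⊆X (proj₁ (meets-only Y (users c) u e e₂)) e₂) loss
      where
        loss : supply Y c ≡ (supply Y left + supply Y right) + cut
        loss rewrite e | e₁ | e₂ = solve 3 (λ a b t → b :- a := ((b :- t) :- a :+ con 0ℚ) :+ t) refl (lo c) (hi c) cut
    ... | true | false | true =
          hall-split Y (len c - cut) (hall-through-v Y Y⊆X (proj₁ (meets-only Y (users c) v e e₁)) e₁) loss
      where
        loss : supply Y c ≡ (supply Y left + supply Y right) + (len c - cut)
        loss rewrite e | e₁ | e₂ = solve 3 (λ a b t → b :- a := (con 0ℚ :+ (b :- (b :- t))) :+ ((b :- a) :- t)) refl (lo c) (hi c) cut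
    ... | true | false | false = contradiction
          (trans (sym (meets-intro Y _ v (proj₁ (meets-only Y (users c) v e e₁)) (without-other u (users c) v (λ v≡u → u≢v (sym v≡u)) v-uses))) e₂)
          λ ()

    lo≤cut-point : lo c ≤ hi c - cut
    lo≤cut-point = begin
      lo c                    ≡⟨ solve 2 (λ a t → a := (a :+ t) :- t) refl (lo c) cut ⟩
      (lo c + cut) - cut      ≤⟨ +-monoˡ-≤ (- cut) (+-monoʳ-≤ (lo c) cut≤len) ⟩
      (lo c + len c) - cut    ≡⟨ solve 3 (λ a b t → (a :+ (b :- a)) :- t := b :- t) refl (lo c) (hi c) cut ⟩
      hi c - cut              ∎
      where open ≤-Reasoning

    cut-point≤hi : hi c - cut ≤ hi c
    cut-point≤hi = begin
      hi c - cut   ≤⟨ +-monoʳ-≤ (hi c) (neg-antimono-≤ cut≥0) ⟩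
      hi c - 0ℚ    ≡⟨ +-identityʳ (hi c) ⟩
      hi c         ∎
      where open ≤-Reasoning

    valid-left : ValidCell left
    valid-left = record
      { ordered    = lo≤cut-point
      ; usersInX   = λ z e → usersInX valid-c z (without-⊆ v (users c) z e)
      ; consistent = Consistent-mono (consistent valid-c) ≤-refl cut-point≤hi (without-⊆ v (users c)) }

    valid-right : ValidCell right
    valid-right = record
      { ordered    = cut-point≤hi
      ; usersInX   = λ z e → usersInX valid-c z (without-⊆ u (users c) z e)
      ; consistent = Consistent-mono (consistent valid-c) lo≤cut-point ≤-refl (without-⊆ u (users c)) }

    chain₁ : ∀ p ds → Chain p (ds ++ c ∷ rest) k → Chain p (ds ++ left ∷ right ∷ rest) k
    chain₁ p []       (lo≡p , ch) = lo≡p , refl , ch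
    chain₁ p (d ∷ ds) (lo≡p , ch) = lo≡p , chain₁ (hi d) ds ch

    boundaries₁ : ∀ ds e → e ∈ map hi (ds ++ c ∷ rest) → e ∈ map hi (ds ++ left ∷ right ∷ rest)
    boundaries₁ []       e (here e≡hi) = there (here e≡hi)
    boundaries₁ []       e (there m)   = there (there m)
    boundaries₁ (d ∷ ds) e (here e≡hi) = here e≡hi
    boundaries₁ (d ∷ ds) e (there m)   = there (boundaries₁ ds e m)

    admissible₁ : Admissible cs₁
    admissible₁ = record
      { chain    = chain₁ 0ℚ pre (chain adm)
      ; valid    = valid₁
      ; keepsPts = keeps
      ; hall     = hall₁ }
      where
        valid₁ : All ValidCell cs₁
        valid₁ with All.++⁻ pre (valid adm)
        ... | valid-pre , (_ ∷ valid-rest) = All.++⁺ valid-pre (valid-left ∷ valid-right ∷ valid-rest)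
        keeps : ∀ e → e ∈ Pts → e ∈ boundaries 0ℚ cs₁
        keeps e m with keepsPts adm e m
        ... | here e≡0 = here e≡0
        ... | there q  = there (boundaries₁ pre e q)

  Exclusive : Fin n → Cell → Set
  Exclusive v d = ∀ u → users d u ≡ true → users d v ≡ true → u ≡ v

  Hereditary : (Cell → Set) → Set
  Hereditary Q = ∀ d d' → users d' ⊆ᵘ users d → Q d → Q d'

  module Isolate (v : Fin n) (Q : Cell → Set) (her : Hereditary Q) where

    Done : Cell → Set
    Done d = Exclusive v d × Q d

    -- c has been split into the Done cells at the end of before and the current cell, which v
    -- shares with no vertex of us
    record InCell (c : Cell) (rest : List Cell) (us : List (Fin n)) : Set where
      field
        before      : List Cell
        current     : Cell
        admissible  : Admissible (before ++ current ∷ rest)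
        before-done : All Done before
        Q-current   : Q current
        shrunk      : users current ⊆ᵘ users c
        handled     : ∀ u → u ∈ us → users current u ≡ true → users current v ≡ true → u ≡ v

    handle : ∀ {c rest us} u (o : InCell c rest us) → let open InCell o in
             (users current u ≡ true → users current v ≡ true → u ≡ v) → InCell c rest (u ∷ us)
    handle {us = us} u o u-ok = record
      { before = before ; current = current ; admissible = admissible ; before-done = before-done
      ; Q-current = Q-current ; shrunk = shrunk ; handled = handled′ }
      where
        open InCell o
        handled′ : ∀ u' → u' ∈ u ∷ us → users current u' ≡ true → users current v ≡ true → u' ≡ v
        handled′ u' (here refl) = u-ok
        handled′ u' (there m)   = handled u' m

    widen : ∀ {c c' rest us} → users c' ⊆ᵘ users c → InCell c' rest us → InCell c rest us
    widen c'⊆c o = record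
      { before = before ; current = current ; admissible = admissible ; before-done = before-done
      ; Q-current = Q-current ; shrunk = λ z e → c'⊆c z (shrunk z e) ; handled = handled }
      where open InCell o

    in-cell : ∀ pre c rest us → Admissible (pre ++ c ∷ rest) → All Done pre → Q c → InCell c rest us
    in-cell pre c rest [] adm done q = record
      { before = pre ; current = c ; admissible = adm ; before-done = done ; Q-current = q
      ; shrunk = λ z e → e ; handled = λ u () }
    in-cell pre c rest (u ∷ us) adm done q with u ≟ v | users c u in u-uses | users c v in v-uses
    ... | yes u≡v | _     | _     = handle u (in-cell pre c rest us adm done q) λ _ _ → u≡v
    ... | no _    | false | _     = handle u o λ e _ → contradiction (trans (sym (InCell.shrunk o u e)) u-uses) λ ()
      where o = in-cell pre c rest us adm done q
    ... | no _    | true  | false = handle u o λ _ e → contradiction (trans (sym (InCell.shrunk o v e)) v-uses) λ ()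
      where o = in-cell pre c rest us adm done q
    ... | no u≢v  | true  | true  = handle u (widen (without-⊆ u (users c)) o)
          λ e _ → contradiction (trans (sym (InCell.shrunk o u e)) (without-self u (users c))) λ ()
      where
        open Split pre c rest u v adm u≢v u-uses v-uses
        left-done : Done left
        left-done = (λ u' _ e → contradiction (trans (sym e) (without-self v (users c))) λ ()) ,
                    her c left (without-⊆ v (users c)) q
        o = in-cell (pre ++ left ∷ []) right rest us
              (subst Admissible (sym (++-assoc pre (left ∷ []) (right ∷ rest))) admissible₁)
              (All.++⁺ done (left-done ∷ [])) (her c right (without-⊆ u (users c)) q)

    along : ∀ pre rest → Admissible (pre ++ rest) → All Done pre → All Q rest →
            Σ (List Cell) (λ cs → Admissible cs × All Done cs)
    along pre []         adm done _        = pre , subst Admissible (++-identityʳ pre) adm , done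
    along pre (c ∷ rest) adm done (q ∷ qs) =
      along (before ++ current ∷ []) rest
        (subst Admissible (sym (++-assoc before (current ∷ []) rest)) admissible)
        (All.++⁺ before-done ((exclusive , Q-current) ∷ [])) qs
      where
        open InCell (in-cell pre c rest (allFin n) adm done q)
        exclusive : Exclusive v current
        exclusive u = handled u (∈-allFin u)

  ExclusiveFor : List (Fin n) → Cell → Set
  ExclusiveFor vs d = ∀ v → v ∈ vs → Exclusive v d

  isolate : ∀ vs cs → Admissible cs → Σ (List Cell) (λ cs' → Admissible cs' × All (ExclusiveFor vs) cs')
  isolate []       cs adm = cs , adm , All.universal (λ d v ()) cs
  isolate (v ∷ vs) cs adm with isolate vs cs adm
  ... | cs₁ , adm₁ , excl₁ with Isolate.along v (ExclusiveFor vs) her [] cs₁ adm₁ [] excl₁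
    where
      her : Hereditary (ExclusiveFor vs)
      her _ _ sub q v' m u' u'-uses v'-uses = q v' m u' (sub u' u'-uses) (sub v' v'-uses)
  ...   | cs₂ , adm₂ , done₂ = cs₂ , adm₂ , All.map (λ {d} → combine {d}) done₂
    where
      combine : ∀ {d} → Exclusive v d × ExclusiveFor vs d → ExclusiveFor (v ∷ vs) d
      combine (excl , _) v' (here refl) = excl
      combine (_ , rest) v' (there m)   = rest v' m

  Covers : Cell → ℚ → Set
  Covers d x = lo d ≤ x × x < hi d

  chain-lo≥ : ∀ {p q} cs → Chain p cs q → All ValidCell cs → ∀ {d} → d ∈ cs → p ≤ lo d
  chain-lo≥ (e ∷ cs) (refl , ch) vs        (here refl) = ≤-refl
  chain-lo≥ (e ∷ cs) (refl , ch) (ve ∷ vs) (there m)   = ≤-trans (ordered ve) (chain-lo≥ cs ch vs m)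

  chain-end≤ : ∀ {p q} cs → Chain p cs q → All ValidCell cs → p ≤ q
  chain-end≤ []       refl        _         = ≤-refl
  chain-end≤ (e ∷ cs) (refl , ch) (ve ∷ vs) = ≤-trans (ordered ve) (chain-end≤ cs ch vs)

  chain-hi≤ : ∀ {p q} cs → Chain p cs q → All ValidCell cs → ∀ {d} → d ∈ cs → hi d ≤ q
  chain-hi≤ (e ∷ cs) (refl , ch) (_ ∷ vs) (here refl) = chain-end≤ cs ch vs
  chain-hi≤ (e ∷ cs) (refl , ch) (_ ∷ vs) (there m)   = chain-hi≤ cs ch vs m

  chain-covers-unique : ∀ {p q} cs → Chain p cs q → All ValidCell cs →
                        ∀ {d d' x} → d ∈ cs → d' ∈ cs → Covers d x → Covers d' x → d ≡ d'
  chain-covers-unique (e ∷ cs) ch          vs       (here refl) (here refl) _ _ = refl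
  chain-covers-unique (e ∷ cs) (refl , ch) (_ ∷ vs) (here refl) (there m') (_ , x<hi) (lo≤x , _) =
    contradiction (≤-trans (chain-lo≥ cs ch vs m') lo≤x) (<⇒≱ x<hi)
  chain-covers-unique (e ∷ cs) (refl , ch) (_ ∷ vs) (there m)   (here refl) (lo≤x , _) (_ , x<hi) =
    contradiction (≤-trans (chain-lo≥ cs ch vs m) lo≤x) (<⇒≱ x<hi)
  chain-covers-unique (e ∷ cs) (refl , ch) (_ ∷ vs) (there m)   (there m') cov cov' =
    chain-covers-unique cs ch vs m m' cov cov'

  chain-sorted : ∀ {p q} cs → Chain p cs q → All ValidCell cs → Sorted (boundaries p cs)
  chain-sorted []       _           _         = [-]
  chain-sorted (e ∷ cs) (refl , ch) (ve ∷ vs) = ordered ve ∷ chain-sorted cs ch vs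

  lo∈boundaries : ∀ {p q} cs → Chain p cs q → ∀ {d} → d ∈ cs → lo d ∈ boundaries p cs
  lo∈boundaries (e ∷ cs) (refl , ch) (here refl) = here refl
  lo∈boundaries (e ∷ cs) (refl , ch) (there m)   = there (lo∈boundaries cs ch m)

  hi∈boundaries : ∀ {p} cs → ∀ {d} → d ∈ cs → hi d ∈ boundaries p cs
  hi∈boundaries (e ∷ cs) (here refl) = there (here refl)
  hi∈boundaries (e ∷ cs) (there m)   = there (hi∈boundaries cs m)

  stepSum-chain : ∀ {p q} cs → Chain p cs q → All ValidCell cs → (χ : ℚ → Bool) (g : Cell → Bool) →
    (∀ d → d ∈ cs → lo d < hi d → χ (lo d) ≡ g d) →
    stepSum χ (boundaries p cs) ≡ sumBy (λ d → if g d then len d else 0ℚ) cs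
  stepSum-chain []       _           _         χ g h = refl
  stepSum-chain (e ∷ cs) (refl , ch) (ve ∷ vs) χ g h =
    cong₂ _+_ first (stepSum-chain cs ch vs χ g (λ d m → h d (there m)))
    where
      first : (if χ (lo e) then hi e - lo e else 0ℚ) ≡ (if g e then len e else 0ℚ)
      first with ≤⇒<⊎≡ (ordered ve)
      ... | inj₁ lo<hi rewrite h e (here refl) lo<hi = refl
      ... | inj₂ lo≡hi rewrite lo≡hi with χ (hi e) | g e
      ...   | true  | true  = refl
      ...   | true  | false = +-inverseʳ (hi e)
      ...   | false | true  = sym (+-inverseʳ (hi e))
      ...   | false | false = refl

module Recolouring {n : ℕ} (G : Graph n) (k : ℚ) (w : Fin n → ℚ) (κ : Assignment n)
  (0≤k : 0ℚ ≤ k) (w≥0 : ∀ v → 0ℚ ≤ w v) (pc : IsPartialColouring G k κ) (X : Subset n)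
  (deficient⇒∈X : ∀ v → measure (κ[_]ᵛ G κ v) < w v → v ∈ₛ X)
  (hallκ : ∀ (X' : Subset n) → X' ⊆ₛ X →
           sumOver X' w ≤ measure (⋃ᴿ (map (λ v → if v ∈ᵇ X' then avail G k κ v else ∅ᴿ) (allFin n)))) where

  open import Data.Bool.Properties using (T?; T-≡; ∧-identityʳ; ∨-identityʳ)
  open import Function.Bundles using (Equivalence)
  open import Data.List.Membership.Propositional using (_∈_)
  open import Data.List.Membership.Propositional.Properties
    using (∈-++⁺ˡ; ∈-++⁺ʳ; ∈-++⁻; ∈-map⁺; ∈-map⁻; ∈-allFin; ∈-filter⁺; ∈-filter⁻)
  open import Data.List.Relation.Unary.All as All using (All; []; _∷_)
  open import Data.List.Relation.Unary.Linked using ([-]; _∷_)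
  open import Data.List.Relation.Binary.Permutation.Propositional using (↭-sym)
  open import Data.List.Relation.Binary.Permutation.Propositional.Properties using (∈-resp-↭)
  open import Data.List.Sort.Base using (SortingAlgorithm)
  open import Data.List.Sort.MergeSort ≤-decTotalOrder using (mergeSort)
  open import Data.Vec using (tabulate)
  open import Data.Vec.Properties using (lookup∘tabulate; []=⇒lookup; lookup⇒[]=)
  open import Data.Fin.Subset using (⁅_⁆)
  open import Data.Fin.Subset.Properties using (x∈⁅x⁆; x∈⁅y⁆⇒x≡y)
  import Data.Vec.Properties as Vec
  import Data.Bool.Properties as Bool
  open OrderFacts
  open Folds
  open Measure

  κᵛ : Fin n → Region
  κᵛ = κ[_]ᵛ G κ

  α : Fin n → Region
  α = avail G k κ

  _≟ˢ_ : (S T : Subset n) → Dec (S ≡ T)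
  _≟ˢ_ = Vec.≡-dec Bool._≟_

  stableSets⁻ : ∀ {S} → S ∈ stableSets G → Stable G S
  stableSets⁻ m = Equivalence.to T-≡ (proj₂ (∈-filter⁻ (λ S → T? (stableᵇ G S)) {xs = allSubsets n} m))

  stableSets⁺ : ∀ {S} → Stable G S → S ∈ stableSets G
  stableSets⁺ {S} st = ∈-filter⁺ (λ S → T? (stableᵇ G S)) (∈-allSubsets S) (Equivalence.from T-≡ st)

  stable-nonadjacent : ∀ S → Stable G S → ∀ u z → lookup S u ≡ true → lookup S z ≡ true → adj G u z ≡ false
  stable-nonadjacent S st u z u∈S z∈S
    with allᵇ-elim _ (allFin n) (allᵇ-elim _ (allFin n) st (∈-allFin u)) (∈-allFin z)
  ... | q rewrite u∈S | z∈S with adj G u z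
  ...   | false = refl

  stable-intro : ∀ S → (∀ u z → lookup S u ≡ true → lookup S z ≡ true → adj G u z ≡ false) → Stable G S
  stable-intro S nonadjacent = allᵇ-intro _ (allFin n) λ u → allᵇ-intro _ (allFin n) λ z → pair-ok u z
    where
      pair-ok : ∀ u z → not (lookup S u ∧ lookup S z ∧ adj G u z) ≡ true
      pair-ok u z with lookup S u in u∈S | lookup S z in z∈S
      ... | false | _    = refl
      ... | true  | false = refl
      ... | true  | true rewrite nonadjacent u z u∈S z∈S = refl

  memᴿ-κᵛ⁻ : ∀ u x → memᴿ (κᵛ u) x ≡ true →
             Σ (Subset n) (λ S → S ∈ stableSets G × lookup S u ≡ true × memᴿ (toRegion (κ S)) x ≡ true)
  memᴿ-κᵛ⁻ u x e with anyᵇ-witness _ (stableSets G) (trans (sym (memᴿ-⋃ᴿ-map _ (stableSets G) x)) e)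
  ... | S , m , q with lookup S u in u∈S
  ...   | true = S , m , u∈S , q

  available-uncoloured : ∀ o x z → memᴿ (α o) x ≡ true → adj G o z ≡ true → memᴿ (κᵛ z) x ≡ false
  available-uncoloured o x z o-avail adj-oz with memᴿ (κᵛ z) x in z-col
  ... | false = refl
  ... | true  = contradiction (trans (sym o-avail)
                  (trans (cong (λ b → memᴿ (ival 0ℚ k) x ∧ not b) neighbour-coloured) (∧-zeroʳ _))) λ ()
    where
      neighbour-coloured : memᴿ (⋃ᴿ (map (λ u → if adj G o u then κᵛ u else ∅ᴿ) (allFin n))) x ≡ true
      neighbour-coloured = trans (memᴿ-⋃ᴿ-map _ (allFin n) x) (anyᵇ-intro _ (allFin n) (∈-allFin z) coloured)
        where
          coloured : memᴿ (if adj G o z then κᵛ z else ∅ᴿ) x ≡ true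
          coloured rewrite adj-oz = z-col

  -- two vertices sharing a colour of κ lie in a common class, since the classes are disjoint
  same-colour-nonadjacent : ∀ x u z → memᴿ (κᵛ u) x ≡ true → memᴿ (κᵛ z) x ≡ true → adj G u z ≡ false
  same-colour-nonadjacent x u z u-col z-col with memᴿ-κᵛ⁻ u x u-col | memᴿ-κᵛ⁻ z x z-col
  ... | S₁ , m₁ , u∈S₁ , x∈S₁ | S₂ , m₂ , z∈S₂ , x∈S₂ with S₁ ≟ˢ S₂
  ...   | yes refl = stable-nonadjacent S₁ (stableSets⁻ m₁) u z u∈S₁ z∈S₂
  ...   | no S₁≢S₂ = contradiction
          (trans (sym x∈S₂) (IsPartialColouring.disjoint pc S₁ S₂ (stableSets⁻ m₁) (stableSets⁻ m₂) S₁≢S₂ x x∈S₁))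
          λ ()

  Pts : List ℚ
  Pts = endsᴿ (⋃ᴿ (map (λ S → toRegion (κ S)) (stableSets G)))

  record Consistent (a b : ℚ) (U : Fin n → Bool) (S : Subset n) : Set where
    field
      available : ∀ z x → a ≤ x → x < b → U z ≡ true → memᴿ (α z) x ≡ true
      coloured  : ∀ z x → a ≤ x → x < b → memᴿ (κᵛ z) x ≡ lookup S z
  open Consistent

  Consistent-mono : ∀ {a b U S a' b' U'} → Consistent a b U S → a ≤ a' → b' ≤ b →
                    (∀ z → U' z ≡ true → U z ≡ true) → Consistent a' b' U' S
  Consistent-mono c a≤a' b'≤b U'⊆U = record
    { available = λ z x a'≤x x<b' e → available c z x (≤-trans a≤a' a'≤x) (<-≤-trans x<b' b'≤b) (U'⊆U z e)
    ; coloured  = λ z x a'≤x x<b' → coloured c z x (≤-trans a≤a' a'≤x) (<-≤-trans x<b' b'≤b) }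

  open Splitting X w k Pts Consistent Consistent-mono

  Pts-range : ∀ {e} → e ∈ Pts → 0ℚ ≤ e × e ≤ k
  Pts-range m with endsᴿ-⋃ᴿ-map⁻ (λ S → toRegion (κ S)) (stableSets G) m
  ... | S , S-stable , q with endsᴿ-⋃ᴿ-map⁻ _ (κ S) q
  ...   | (a , b) , ab∈κS , r with IsPartialColouring.inRange pc S (stableSets⁻ S-stable) ab∈κS
  ...     | 0≤a , a≤b , b≤k with r
  ...       | here refl         = 0≤a , ≤-trans a≤b b≤k
  ...       | there (here refl) = ≤-trans 0≤a a≤b , b≤k

  open SortingAlgorithm mergeSort using (sort; sort-↗; sort-↭)

  gridPoints : List ℚ
  gridPoints = sort Pts ++ k ∷ []

  ∈-sort : ∀ {e} → e ∈ Pts → e ∈ sort Pts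
  ∈-sort = ∈-resp-↭ (↭-sym (sort-↭ Pts))

  sort-∈ : ∀ {e} → e ∈ sort Pts → e ∈ Pts
  sort-∈ = ∈-resp-↭ (sort-↭ Pts)

  gridPoints-range : ∀ {e} → e ∈ gridPoints → 0ℚ ≤ e × e ≤ k
  gridPoints-range m with ∈-++⁻ (sort Pts) m
  ... | inj₁ q          = Pts-range (sort-∈ q)
  ... | inj₂ (here refl) = 0≤k , ≤-refl

  ++-last-sorted : ∀ s → Sorted s → (∀ {e} → e ∈ s → e ≤ k) → Sorted (s ++ k ∷ [])
  ++-last-sorted []          _          _ = [-]
  ++-last-sorted (x ∷ [])    _          h = h (here refl) ∷ [-]
  ++-last-sorted (x ∷ y ∷ s) (x≤y ∷ s↗) h = x≤y ∷ ++-last-sorted (y ∷ s) s↗ (λ m → h (there m))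

  ∷-sorted : ∀ p s → Sorted s → (∀ {e} → e ∈ s → p ≤ e) → Sorted (p ∷ s)
  ∷-sorted p []      _  _ = [-]
  ∷-sorted p (x ∷ s) s↗ h = h (here refl) ∷ s↗

  grid↗ : Sorted (0ℚ ∷ gridPoints)
  grid↗ = ∷-sorted 0ℚ gridPoints
            (++-last-sorted (sort Pts) (sort-↗ Pts) (λ m → proj₂ (Pts-range (sort-∈ m))))
            (λ m → proj₁ (gridPoints-range m))

  usersAt : ℚ → Fin n → Bool
  usersAt p z = lookup X z ∧ memᴿ (α z) p

  classAt : ℚ → Subset n
  classAt p = tabulate (λ z → memᴿ (κᵛ z) p)

  grid : ℚ → List ℚ → List Cell
  grid p []       = []
  grid p (q ∷ qs) = cell p q (usersAt p) (classAt p) ∷ grid q qs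

  boundaries-grid : ∀ p qs → boundaries p (grid p qs) ≡ p ∷ qs
  boundaries-grid p []       = refl
  boundaries-grid p (q ∷ qs) = cong (p ∷_) (boundaries-grid q qs)

  grid-chain : ∀ p s → Chain p (grid p (s ++ k ∷ [])) k
  grid-chain p []      = refl , refl
  grid-chain p (x ∷ s) = refl , grid-chain x s

  grid-lo≥ : ∀ p qs → Sorted (p ∷ qs) → ∀ {d} → d ∈ grid p qs → p ≤ lo d
  grid-lo≥ p (q ∷ qs) _           (here refl) = ≤-refl
  grid-lo≥ p (q ∷ qs) (p≤q ∷ qs↗) (there m)   = ≤-trans p≤q (grid-lo≥ q qs qs↗ m)

  grid-cell-empty : ∀ p qs → Sorted (p ∷ qs) → ∀ {d} → d ∈ grid p qs → ∀ e → e ∈ p ∷ qs → e ≤ lo d ⊎ hi d ≤ e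
  grid-cell-empty p (q ∷ qs) qs↗         (here refl) e (here refl) = inj₁ ≤-refl
  grid-cell-empty p (q ∷ qs) (_ ∷ qs↗)   (here refl) e (there m)   = inj₂ (head≤ qs↗ m)
  grid-cell-empty p (q ∷ qs) (p≤q ∷ qs↗) (there md)  e (here refl) = inj₁ (≤-trans p≤q (grid-lo≥ q qs qs↗ md))
  grid-cell-empty p (q ∷ qs) (_ ∷ qs↗)   (there md)  e (there m)   = grid-cell-empty q qs qs↗ md e m

  grid-ordered : ∀ p qs → Sorted (p ∷ qs) → ∀ {d} → d ∈ grid p qs → lo d ≤ hi d
  grid-ordered p (q ∷ qs) (p≤q ∷ _)   (here refl) = p≤q
  grid-ordered p (q ∷ qs) (_ ∷ qs↗)   (there m)   = grid-ordered q qs qs↗ m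

  grid-users : ∀ p qs → ∀ {d} → d ∈ grid p qs → users d ≡ usersAt (lo d)
  grid-users p (q ∷ qs) (here refl) = refl
  grid-users p (q ∷ qs) (there m)   = grid-users q qs m

  grid-class : ∀ p qs → ∀ {d} → d ∈ grid p qs → oldClass d ≡ classAt (lo d)
  grid-class p (q ∷ qs) (here refl) = refl
  grid-class p (q ∷ qs) (there m)   = grid-class q qs m

  grid₀ : List Cell
  grid₀ = grid 0ℚ gridPoints

  endsᴿ-κᵛ : ∀ z {e} → e ∈ endsᴿ (κᵛ z) → e ∈ Pts
  endsᴿ-κᵛ z m with endsᴿ-⋃ᴿ-map⁻ (λ S → if z ∈ᵇ S then toRegion (κ S) else ∅ᴿ) (stableSets G) m
  ... | S , S-stable , q with lookup S z
  ...   | true = endsᴿ-⋃ᴿ-map⁺ (λ S → toRegion (κ S)) (stableSets G) S-stable q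

  Pts⊆grid : ∀ {e} → e ∈ Pts → e ∈ 0ℚ ∷ gridPoints
  Pts⊆grid m = there (∈-++⁺ˡ (∈-sort m))

  endsᴿ-α : ∀ z {e} → e ∈ endsᴿ (α z) → e ∈ 0ℚ ∷ gridPoints
  endsᴿ-α z (here refl)         = here refl
  endsᴿ-α z (there (here refl)) = there (∈-++⁺ʳ (sort Pts) (here refl))
  endsᴿ-α z (there (there m)) with endsᴿ-⋃ᴿ-map⁻ (λ u → if adj G z u then κᵛ u else ∅ᴿ) (allFin n) m
  ... | u , _ , q with adj G z u
  ...   | true = Pts⊆grid (endsᴿ-κᵛ u q)

  availableTo : Subset n → Region
  availableTo Y = ⋃ᴿ (map (λ v → if v ∈ᵇ Y then α v else ∅ᴿ) (allFin n))

  endsᴿ-availableTo : ∀ Y {e} → e ∈ endsᴿ (availableTo Y) → e ∈ 0ℚ ∷ gridPoints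
  endsᴿ-availableTo Y m with endsᴿ-⋃ᴿ-map⁻ (λ v → if v ∈ᵇ Y then α v else ∅ᴿ) (allFin n) m
  ... | z , _ , q with lookup Y z
  ...   | true = endsᴿ-α z q

  grid-constant : ∀ r → (∀ {e} → e ∈ endsᴿ r → e ∈ 0ℚ ∷ gridPoints) →
                  ∀ {d} → d ∈ grid₀ → ∀ x → lo d ≤ x → x < hi d → memᴿ r x ≡ memᴿ r (lo d)
  grid-constant r ends⊆ {d} m x lo≤x x<hi = sym (memᴿ-constant r (lo d) x lo≤x separated)
    where
      separated : ∀ e → e ∈ endsᴿ r → e ≤ lo d ⊎ x < e
      separated e e∈ with grid-cell-empty 0ℚ gridPoints grid↗ m e (ends⊆ e∈)
      ... | inj₁ e≤lo = inj₁ e≤lo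
      ... | inj₂ hi≤e = inj₂ (<-≤-trans x<hi hi≤e)

  grid₀-valid : All ValidCell grid₀
  grid₀-valid = All.tabulate valid-cell
    where
      valid-cell : ∀ {d} → d ∈ grid₀ → ValidCell d
      valid-cell {d} m = record
        { ordered    = grid-ordered 0ℚ gridPoints grid↗ m
        ; usersInX   = λ z e → proj₁ (∧-≡true {lookup X z} (subst (λ U → U z ≡ true) (grid-users 0ℚ gridPoints m) e))
        ; consistent = record
          { available = λ z x lo≤x x<hi e → trans (grid-constant (α z) (endsᴿ-α z) m x lo≤x x<hi)
              (proj₂ (∧-≡true {lookup X z} (subst (λ U → U z ≡ true) (grid-users 0ℚ gridPoints m) e)))
          ; coloured  = λ z x lo≤x x<hi → trans (grid-constant (κᵛ z) (λ q → Pts⊆grid (endsᴿ-κᵛ z q)) m x lo≤x x<hi)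
              (trans (sym (lookup∘tabulate _ z)) (cong (λ S → lookup S z) (sym (grid-class 0ℚ gridPoints m)))) } }

  ⊆X⇒⊆ₛ : ∀ Y → Y ⊆X → Y ⊆ₛ X
  ⊆X⇒⊆ₛ Y Y⊆X {x} m = lookup⇒[]= x X (Y⊆X x ([]=⇒lookup m))

  -- Hall's condition for the grid is the hypothesis, computed cell by cell
  grid₀-hall : Hall grid₀
  grid₀-hall Y Y⊆X = subst (sumOver Y w ≤_) supply≡measure (hallκ Y (⊆X⇒⊆ₛ Y Y⊆X))
    where
      at-lo : ∀ d → d ∈ grid₀ → lo d < hi d → memᴿ (availableTo Y) (lo d) ≡ meets Y (users d)
      at-lo d m _ rewrite grid-users 0ℚ gridPoints m =
        trans (memᴿ-⋃ᴿ-map _ (allFin n) (lo d)) (anyᵇ-cong _ _ (allFin n) pointwise)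
        where
          pointwise : ∀ z → memᴿ (if lookup Y z then α z else ∅ᴿ) (lo d) ≡ (lookup Y z ∧ usersAt (lo d) z)
          pointwise z with lookup Y z in z∈Y
          ... | false = refl
          ... | true rewrite Y⊆X z z∈Y = refl
      supply≡measure : measure (availableTo Y) ≡ totalSupply Y grid₀
      supply≡measure = begin
        measure (availableTo Y)                                      ≡⟨ measure≡stepSum (availableTo Y) _ grid↗ (λ e → endsᴿ-availableTo Y) ⟩
        stepSum (memᴿ (availableTo Y)) (0ℚ ∷ gridPoints)              ≡⟨ cong (stepSum (memᴿ (availableTo Y))) (sym (boundaries-grid 0ℚ gridPoints)) ⟩
        stepSum (memᴿ (availableTo Y)) (boundaries 0ℚ grid₀)          ≡⟨ stepSum-chain grid₀ (grid-chain 0ℚ (sort Pts)) grid₀-valid _ _ at-lo ⟩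
        totalSupply Y grid₀                                          ∎
        where open ≡-Reasoning

  grid₀-admissible : Admissible grid₀
  grid₀-admissible = record
    { chain    = grid-chain 0ℚ (sort Pts)
    ; valid    = grid₀-valid
    ; keepsPts = λ e m → subst (e ∈_) (sym (boundaries-grid 0ℚ gridPoints)) (Pts⊆grid m)
    ; hall     = grid₀-hall }

  isolated : Σ (List Cell) (λ cs → Admissible cs × All (ExclusiveFor (allFin n)) cs)
  isolated = isolate (allFin n) grid₀ grid₀-admissible

  cells : List Cell
  cells = proj₁ isolated

  cells-admissible : Admissible cells
  cells-admissible = proj₁ (proj₂ isolated)

  cells-exclusive : All (ExclusiveFor (allFin n)) cells
  cells-exclusive = proj₂ (proj₂ isolated)

  cells-valid : ∀ {d} → d ∈ cells → ValidCell d
  cells-valid = All.lookup (valid cells-admissible)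

  cells-chain : Chain 0ℚ cells k
  cells-chain = chain cells-admissible

  newClass : Cell → Subset n
  newClass d = tabulate (λ z → (lookup (oldClass d) z ∧ not (lookup X z)) ∨ users d z)

  interval : Cell → ℚ × ℚ
  interval d = lo d , hi d

  κ' : Assignment n
  κ' T = map interval (filter (λ d → newClass d ≟ˢ T) cells)

  memᴿ-κ'⁻ : ∀ T x → memᴿ (toRegion (κ' T)) x ≡ true → Σ Cell (λ d → d ∈ cells × newClass d ≡ T × Covers d x)
  memᴿ-κ'⁻ T x e with anyᵇ-witness _ _ (trans (sym (memᴿ-⋃ᴿ-map _ (κ' T) x)) e)
  ... | ab , ab∈ , x∈ab with ∈-map⁻ interval ab∈
  ...   | d , d∈ , refl with ∈-filter⁻ (λ d → newClass d ≟ˢ T) {xs = cells} d∈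
  ...     | d∈cells , class≡T = d , d∈cells , class≡T , memᴿ-ival⁻ (lo d) (hi d) x x∈ab

  memᴿ-κ'⁺ : ∀ d x → d ∈ cells → Covers d x → memᴿ (toRegion (κ' (newClass d))) x ≡ true
  memᴿ-κ'⁺ d x d∈ (lo≤x , x<hi) = trans (memᴿ-⋃ᴿ-map _ (κ' (newClass d)) x)
    (anyᵇ-intro _ _ (∈-map⁺ interval (∈-filter⁺ (λ d' → newClass d' ≟ˢ (newClass d)) d∈ refl))
                    (memᴿ-ival⁺ (lo d) (hi d) x lo≤x x<hi))

  newClass-stable : ∀ d → d ∈ cells → lo d < hi d → Stable G (newClass d)
  newClass-stable d d∈ lo<hi = stable-intro (newClass d) nonadjacent
    where
      cons = consistent (cells-valid d∈)
      x = lo d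
      member : ∀ u → lookup (newClass d) u ≡ true → users d u ≡ true ⊎ memᴿ (κᵛ u) x ≡ true
      member u e with ∨-≡true {lookup (oldClass d) u ∧ not (lookup X u)} (trans (sym (lookup∘tabulate _ u)) e)
      ... | inj₂ uses = inj₁ uses
      ... | inj₁ old  = inj₂ (trans (coloured cons u x ≤-refl lo<hi) (proj₁ (∧-≡true old)))
      nonadjacent : ∀ u z → lookup (newClass d) u ≡ true → lookup (newClass d) z ≡ true → adj G u z ≡ false
      nonadjacent u z u∈ z∈ with member u u∈ | member z z∈
      ... | inj₁ u-uses | inj₁ z-uses
            rewrite All.lookup cells-exclusive d∈ z (∈-allFin z) u u-uses z-uses = irrefl G z
      ... | inj₁ u-uses | inj₂ z-col with adj G u z in adj-uz
      ...   | false = refl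
      ...   | true  = contradiction (trans (sym z-col)
                        (available-uncoloured u x z (available cons u x ≤-refl lo<hi u-uses) adj-uz)) λ ()
      nonadjacent u z u∈ z∈ | inj₂ u-col | inj₁ z-uses with adj G u z in adj-uz
      ...   | false = refl
      ...   | true  = contradiction (trans (sym u-col)
                        (available-uncoloured z x u (available cons z x ≤-refl lo<hi z-uses) (trans (adj-sym G z u) adj-uz))) λ ()
      nonadjacent u z u∈ z∈ | inj₂ u-col | inj₂ z-col = same-colour-nonadjacent x u z u-col z-col

  κ'-disjoint : ∀ T T' → Stable G T → Stable G T' → T ≢ T' → ∀ x →
                memᴿ (toRegion (κ' T)) x ≡ true → memᴿ (toRegion (κ' T')) x ≡ false
  κ'-disjoint T T' _ _ T≢T' x e with memᴿ (toRegion (κ' T')) x in e'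
  ... | false = refl
  ... | true with memᴿ-κ'⁻ T x e | memᴿ-κ'⁻ T' x e'
  ...   | d , d∈ , refl , cov | d' , d'∈ , refl , cov'
          with chain-covers-unique cells cells-chain (valid cells-admissible) d∈ d'∈ cov cov'
  ...     | refl = contradiction refl T≢T'

  κ'-inRange : ∀ T → Stable G T → ∀ {a b} → (a , b) ∈ κ' T → 0ℚ ≤ a × a ≤ b × b ≤ k
  κ'-inRange T _ m with ∈-map⁻ interval m
  ... | d , d∈ , refl with ∈-filter⁻ (λ d → newClass d ≟ˢ T) {xs = cells} d∈
  ...   | d∈cells , _ = chain-lo≥ cells cells-chain (valid cells-admissible) d∈cells ,
                        ordered (cells-valid d∈cells) ,
                        chain-hi≤ cells cells-chain (valid cells-admissible) d∈cells

  κ'-partial : IsPartialColouring G k κ'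
  κ'-partial = record { inRange = κ'-inRange ; disjoint = κ'-disjoint }

  memᴿ-κ'ᵛ : ∀ v x d → d ∈ cells → Covers d x → memᴿ (κ[_]ᵛ G κ' v) x ≡ lookup (newClass d) v
  memᴿ-κ'ᵛ v x d d∈ cov = ≡true-ext to from
    where
      to : memᴿ (κ[_]ᵛ G κ' v) x ≡ true → lookup (newClass d) v ≡ true
      to e with anyᵇ-witness _ (stableSets G) (trans (sym (memᴿ-⋃ᴿ-map _ (stableSets G) x)) e)
      ... | T , _ , q with lookup T v in v∈T
      ...   | true with memᴿ-κ'⁻ T x q
      ...     | d' , d'∈ , refl , cov' with chain-covers-unique cells cells-chain (valid cells-admissible) d∈ d'∈ cov cov'
      ...       | refl = v∈T
      from : lookup (newClass d) v ≡ true → memᴿ (κ[_]ᵛ G κ' v) x ≡ true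
      from e = trans (memᴿ-⋃ᴿ-map _ (stableSets G) x)
        (anyᵇ-intro _ (stableSets G) (stableSets⁺ {newClass d} (newClass-stable d d∈ (≤-<-trans (proj₁ cov) (proj₂ cov)))) in-class)
        where
          in-class : memᴿ (if lookup (newClass d) v then toRegion (κ' (newClass d)) else ∅ᴿ) x ≡ true
          in-class rewrite e = memᴿ-κ'⁺ d x d∈ cov

  endsᴿ-κ'ᵛ : ∀ v {e} → e ∈ endsᴿ (κ[_]ᵛ G κ' v) → e ∈ boundaries 0ℚ cells
  endsᴿ-κ'ᵛ v m with endsᴿ-⋃ᴿ-map⁻ (λ T → if v ∈ᵇ T then toRegion (κ' T) else ∅ᴿ) (stableSets G) m
  ... | T , _ , q with lookup T v
  ...   | true with endsᴿ-⋃ᴿ-map⁻ _ (κ' T) q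
  ...     | (a , b) , ab∈ , r with ∈-map⁻ interval ab∈
  ...       | d , d∈ , refl with ∈-filter⁻ (λ d → newClass d ≟ˢ T) {xs = cells} d∈
  ...         | d∈cells , _ with r
  ...           | here refl         = lo∈boundaries cells cells-chain d∈cells
  ...           | there (here refl) = hi∈boundaries cells d∈cells

  measure-by-cells : ∀ r (g : Cell → Bool) → (∀ {e} → e ∈ endsᴿ r → e ∈ boundaries 0ℚ cells) →
    (∀ d → d ∈ cells → lo d < hi d → memᴿ r (lo d) ≡ g d) →
    measure r ≡ sumBy (λ d → if g d then len d else 0ℚ) cells
  measure-by-cells r g ends⊆ at-lo =
    trans (measure≡stepSum r (boundaries 0ℚ cells) (chain-sorted cells cells-chain (valid cells-admissible)) (λ e → ends⊆))
          (stepSum-chain cells cells-chain (valid cells-admissible) (memᴿ r) g at-lo)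

  measure-κ'ᵛ : ∀ v → measure (κ[_]ᵛ G κ' v) ≡ sumBy (λ d → if lookup (newClass d) v then len d else 0ℚ) cells
  measure-κ'ᵛ v = measure-by-cells (κ[_]ᵛ G κ' v) (λ d → lookup (newClass d) v) (endsᴿ-κ'ᵛ v)
    (λ d d∈ lo<hi → memᴿ-κ'ᵛ v (lo d) d d∈ (≤-refl , lo<hi))

  measure-κᵛ : ∀ v → measure (κᵛ v) ≡ sumBy (λ d → if lookup (oldClass d) v then len d else 0ℚ) cells
  measure-κᵛ v = measure-by-cells (κᵛ v) (λ d → lookup (oldClass d) v)
    (λ m → keepsPts cells-admissible _ (endsᴿ-κᵛ v m))
    (λ d d∈ lo<hi → coloured (consistent (cells-valid d∈)) v (lo d) ≤-refl lo<hi)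

  w≤sumOver-⁅⁆ : ∀ v → w v ≤ sumOver ⁅ v ⁆ w
  w≤sumOver-⁅⁆ v = subst (_≤ sumOver ⁅ v ⁆ w) (cong (λ b → if b then w v else 0ℚ) v∈⁅v⁆)
    (term≤sumBy (λ z → if lookup ⁅ v ⁆ z then w z else 0ℚ) (allFin n) nonneg (∈-allFin v))
    where
      v∈⁅v⁆ = []=⇒lookup (x∈⁅x⁆ v)
      nonneg : ∀ z → 0ℚ ≤ (if lookup ⁅ v ⁆ z then w z else 0ℚ)
      nonneg z with lookup ⁅ v ⁆ z
      ... | true  = w≥0 z
      ... | false = ≤-refl

  meets-⁅⁆ : ∀ v U → meets ⁅ v ⁆ U ≡ U v
  meets-⁅⁆ v U = ≡true-ext to (meets-intro ⁅ v ⁆ U v ([]=⇒lookup (x∈⁅x⁆ v)))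
    where
      to : meets ⁅ v ⁆ U ≡ true → U v ≡ true
      to e with meets-witness ⁅ v ⁆ U e
      ... | z , z∈ , Uz with x∈⁅y⁆⇒x≡y v (lookup⇒[]= z ⁅ v ⁆ z∈)
      ...   | refl = Uz

  users-outside-X : ∀ v d → d ∈ cells → lookup X v ≡ false → users d v ≡ false
  users-outside-X v d d∈ v∉X with users d v in uses
  ... | false = refl
  ... | true  = contradiction (trans (sym (usersInX (cells-valid d∈) v uses)) v∉X) λ ()

  κ'-enough-in-X : ∀ v → lookup X v ≡ true → w v ≤ measure (κ[_]ᵛ G κ' v)
  κ'-enough-in-X v v∈X = begin
    w v                      ≤⟨ w≤sumOver-⁅⁆ v ⟩
    sumOver ⁅ v ⁆ w          ≤⟨ hall cells-admissible ⁅ v ⁆ ⁅v⁆⊆X ⟩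
    totalSupply ⁅ v ⁆ cells  ≡⟨ sumBy-congᴬ _ _ cells (All.tabulate pointwise) ⟩
    sumBy (λ d → if lookup (newClass d) v then len d else 0ℚ) cells ≡⟨ sym (measure-κ'ᵛ v) ⟩
    measure (κ[_]ᵛ G κ' v)   ∎
    where
      open ≤-Reasoning
      ⁅v⁆⊆X : ⁅ v ⁆ ⊆X
      ⁅v⁆⊆X z e rewrite x∈⁅y⁆⇒x≡y v (lookup⇒[]= z ⁅ v ⁆ e) = v∈X
      pointwise : ∀ {d} → d ∈ cells → supply ⁅ v ⁆ d ≡ (if lookup (newClass d) v then len d else 0ℚ)
      pointwise {d} _ rewrite lookup∘tabulate (λ z → (lookup (oldClass d) z ∧ not (lookup X z)) ∨ users d z) v
                            | v∈X | ∧-zeroʳ (lookup (oldClass d) v) | meets-⁅⁆ v (users d) = refl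

  κ'-enough-outside-X : ∀ v → lookup X v ≡ false → w v ≤ measure (κ[_]ᵛ G κ' v)
  κ'-enough-outside-X v v∉X = begin
    w v                      ≤⟨ ≮⇒≥ not-deficient ⟩
    measure (κᵛ v)           ≡⟨ measure-κᵛ v ⟩
    sumBy (λ d → if lookup (oldClass d) v then len d else 0ℚ) cells ≡⟨ sumBy-congᴬ _ _ cells (All.tabulate pointwise) ⟩
    sumBy (λ d → if lookup (newClass d) v then len d else 0ℚ) cells ≡⟨ sym (measure-κ'ᵛ v) ⟩
    measure (κ[_]ᵛ G κ' v)   ∎
    where
      open ≤-Reasoning
      not-deficient : ¬ (measure (κᵛ v) < w v)
      not-deficient lt = contradiction (trans (sym ([]=⇒lookup (deficient⇒∈X v lt))) v∉X) λ ()
      pointwise : ∀ {d} → d ∈ cells → (if lookup (oldClass d) v then len d else 0ℚ) ≡ (if lookup (newClass d) v then len d else 0ℚ)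
      pointwise {d} d∈ rewrite lookup∘tabulate (λ z → (lookup (oldClass d) z ∧ not (lookup X z)) ∨ users d z) v
                             | v∉X | ∧-identityʳ (lookup (oldClass d) v) | users-outside-X v d d∈ v∉X
                             | ∨-identityʳ (lookup (oldClass d) v) = refl

  extension : Σ (Assignment n) (λ κ'' → IsFractionalColouring G k w κ'')
  extension = κ' , κ'-partial , enough
    where
      enough : ∀ v → w v ≤ measure (κ[_]ᵛ G κ' v)
      enough v with lookup X v in v∈X
      ... | true  = κ'-enough-in-X v v∈X
      ... | false = κ'-enough-outside-X v v∈X

open import Data.Fin.Subset using (_⊆_; _∈_)

lemma1 : ∀ {n} (G : Graph n) (k : ℚ) (w : Fin n → ℚ) (κ : Assignment n) →
    0ℚ ≤ k → (∀ v → 0ℚ ≤ w v) →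
    IsPartialColouring G k κ →
    (X : Subset n) → (∀ v → v ∈ X → measure (κ[_]ᵛ G κ v) < w v) → (∀ v → measure (κ[_]ᵛ G κ v) < w v → v ∈ X) →
    (∀ (X' : Subset n) → X' ⊆ X →
      sumOver X' w ≤ measure (⋃ᴿ (map (λ v → if v ∈ᵇ X' then avail G k κ v else ∅ᴿ) (allFin n)))) →
    Σ (Assignment n) (λ κ' → IsFractionalColouring G k w κ')
-- only the vertices outside X need to be satisfied already
lemma1 G k w κ 0≤k w≥0 pc X _ deficient⇒∈X hall = Recolouring.extension G k w κ 0≤k w≥0 pc X deficient⇒∈X hall
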